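{- For all integers $m,n\ge 1$, define $f_{m,n}\in\mathcal{H}$ by $$f_{m,n}=L_mL_n-\sum_{\substack{0\le i\le m-1\\0\le j\le n-1}}B_+^{\,m-i+n-j-2}\bigl(\bullet\,B_+(L_iL_j)\bigr)+\sum_{\substack{0\le i\le m-1\\0\le j\le n-1\\(i,j)\ne(0,0)}}B_+^{\,m-i+n-j-1}\bigl(\bullet\,L_iL_j\bigr),$$ where $L_0=\mathbb{I}$, $L_k=B_+^{\,k-1}(\bullet)$ is the ladder tree with $k$ vertices for $k\ge 1$, and $B_+^{\,0}$ is the identity. Then $\sigma(f_{m,n})=F_{f_{m,n}}=0$.
   Context: Rooted trees are non-planar, up to isomorphism; forests are commutative products of trees; $\mathbb{I}$ is the empty forest and $\bullet$ the one-vertex tree. $\mathcal{H}$ is the free commutative unital $\mathbb{Q}$-algebra generated by rooted trees. $B_+$ is the $\mathbb{Q}$-linear grafting map: $B_+(\mathbb{I})=\bullet$, and $B_+(t_1\cdots t_n)$ joins the roots of $t_1,\dots,t_n$ to a new common root. Let $\mathfrak{H}=\mathbb{Q}\langle x,y\rangle$. The product $\diamond$ on $\mathfrak{H}$ is the $\mathbb{Q}$-bilinear product with $w\diamond1=1\diamond w=w$ and, for $v,w\in\mathfrak{H}$: $vx\diamond wx=(v\diamond wx)x-(vy\diamond w)x$, $vx\diamond wy=(v\diamond wy)x+(vx\diamond w)y$, $vy\diamond wx=(v\diamond wx)y+(vy\diamond w)x$, $vy\diamond wy=(v\diamond wy)y-(vx\diamond w)y$. It is associative and commutative, and $\mathfrak{H}^1=\mathbb{Q}+\mathfrak{H}y$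 is a subalgebra, denoted $\mathfrak{H}^1_\diamond$. $R_w$ is right multiplication by $w$, $R_y^{ -1}$ removes a final $y$. For forests $f$, define $F_f\in\mathfrak{H}^1$ recursively: $F_{\mathbb{I}}=1$, $F_\bullet=y$, $F_{B_+(f)}=R_yR_{x+2y}R_y^{ -1}(F_f)$ for nonempty forests $f$, and $F_{gh}=F_g\diamond F_h$; extend linearly. $\sigma:\mathcal{H}\to\mathfrak{H}^1_\diamond$, $\sigma(f)=F_f$. -}

module Defs where

open import Data.Nat using (ℕ; zero; suc; _∸_) renaming (_+_ to _+ℕ_)
open import Data.Rational using (ℚ; 0ℚ; 1ℚ; _+_; _*_; -_)
open import Data.List using (List; []; _∷_; _++_; map; concatMap; upTo; foldr)
open import Data.Product using (_×_; _,_)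
open import Data.Bool using (Bool; true; false; if_then_else_)

data Letter : Set where
  x y : Letter

-- A word is stored REVERSED: the head of the list is the LAST letter
-- of the word.  (So  y ∷ x ∷ []  represents the word  x y .)
Word : Set
Word = List Letter

-- A polynomial is a formal finite sum of coefficient-word pairs;
-- two polynomials are equal iff all their coefficients agree (see coeff).
Poly : Set
Poly = List (ℚ × Word)

one : Poly
one = (1ℚ , []) ∷ []

scale : ℚ → Poly → Poly
scale c = map (λ { (d , w) → (c * d , w) })

neg : Poly → Poly
neg = scale (- 1ℚ)

mulR : Letter → Poly → Poly
mulR a = map (λ { (d , w) → (d , a ∷ w) })

letterEq : Letter → Letter → Bool
letterEq x x = true
letterEq y y = true
letterEq _ _ = false

wordEq : Word → Word → Bool
wordEq []      []      = true
wordEq (a ∷ v) (b ∷ w) = if letterEq a b then wordEq v w else false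
wordEq _       _       = false

coeff : Poly → Word → ℚ
coeff [] w = 0ℚ
coeff ((c , v) ∷ p) w = if wordEq v w then c + coeff p w else coeff p w

_◇w_ : Word → Word → Poly
[] ◇w w = (1ℚ , w) ∷ []
(a ∷ v) ◇w [] = (1ℚ , a ∷ v) ∷ []
(x ∷ v) ◇w (x ∷ w) = mulR x ((v ◇w (x ∷ w)) ++ neg ((y ∷ v) ◇w w))
(x ∷ v) ◇w (y ∷ w) = mulR x (v ◇w (y ∷ w)) ++ mulR y ((x ∷ v) ◇w w)
(y ∷ v) ◇w (x ∷ w) = mulR y (v ◇w (x ∷ w)) ++ mulR x ((y ∷ v) ◇w w)
(y ∷ v) ◇w (y ∷ w) = mulR y ((v ◇w (y ∷ w)) ++ neg ((x ∷ v) ◇w w))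

_◇_ : Poly → Poly → Poly
p ◇ q = concatMap (λ { (c , v) → concatMap (λ { (d , w) → scale (c * d) (v ◇w w) }) q }) p

-- R_y R_{x+2y} R_y^{-1}  (R_y^{-1} removes a final y; it is only applied
-- to elements of 𝔥y, on other words we set it to 0).
grow : Poly → Poly
grow = concatMap step
  where
  step : ℚ × Word → Poly
  step (c , y ∷ w) = (c , y ∷ x ∷ w) ∷ ((1ℚ + 1ℚ) * c , y ∷ y ∷ w) ∷ []
  step (c , x ∷ w) = []
  step (c , [])    = []

data Tree : Set where
  node : List Tree → Tree

Forest : Set
Forest = List Tree

B₊ : Forest → Tree
B₊ = node

mutual
  Ftree : Tree → Poly
  Ftree (node [])       = (1ℚ , y ∷ []) ∷ []
  Ftree (node (t ∷ ts)) = grow (Fforest (t ∷ ts))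

  Fforest : Forest → Poly
  Fforest []       = one
  Fforest (t ∷ ts) = Ftree t ◇ Fforest ts

HElem : Set
HElem = List (ℚ × Forest)

σ : HElem → Poly
σ = concatMap (λ { (c , f) → scale c (Fforest f) })

B₊^ : ℕ → Forest → Forest
B₊^ zero    f = f
B₊^ (suc k) f = B₊ (B₊^ k f) ∷ []

• : Tree
• = node []

L : ℕ → Forest
L zero    = []
L (suc k) = B₊^ k (• ∷ [])

fmn : ℕ → ℕ → HElem
fmn m n =
  (1ℚ , L m ++ L n)
  ∷ concatMap (λ i → concatMap (λ j → term₁ i j ++ term₂ i j) (upTo n)) (upTo m)
  where
  term₁ : ℕ → ℕ → HElem
  term₁ i j = (- 1ℚ , B₊^ ((m ∸ 1 ∸ i) +ℕ (n ∸ 1 ∸ j)) (• ∷ B₊ (L i ++ L j) ∷ [])) ∷ []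
  term₂ : ℕ → ℕ → HElem
  term₂ zero zero = []
  term₂ i    j    = (1ℚ , B₊^ (suc ((m ∸ 1 ∸ i) +ℕ (n ∸ 1 ∸ j))) (• ∷ (L i ++ L j))) ∷ []

-- Coefficients are handled as series Word → ℚ, on which ⋄ can be computed letter by letter.
-- σ turns products of forests into ⋄ and B₊ into graft f = (f[] + R_{x+2y} R_y⁻¹ f) y.
-- Two rules drive the argument: R_{x+y} commutes with ⋄, and
--   (P y) ⋄ (Q y) = (P ⋄ Q y + P y ⋄ Q − (P ⋄ Q)(x + y)) y.
-- From them, for u and v each either 1 or in 𝔥y,
--   graft u ⋄ graft v − graft (u ⋄ graft v) − graft (graft u ⋄ v) + graft (graft (u ⋄ v))
--     = y ⋄ graft (u ⋄ v) − graft (y ⋄ (u ⋄ v)).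
-- For u = σ(L_i), v = σ(L_j) this is a first-order recurrence in i and j for σ(L_i L_j),
-- whose inhomogeneous term T(i, j) = y ⋄ graft σ(L_i L_j) − graft (y ⋄ σ(L_i L_j)) is, up to
-- sign and grafting, σ of the (i, j) summand of f_{m,n}. Solving the recurrence by variation
-- of constants, first in j and then in i, gives
--   σ(L_m L_n) = σ(L_{m+n}) + Σ_{i<m, j<n} graft^{(m-1-i)+(n-1-j)} T(i, j),
-- and σ(L_{m+n}) is exactly the second term missing from the (0, 0) summand.
module Submission where

open import Defs
open import Data.Nat using (ℕ; zero; suc; _∸_; _≤_; z≤n; s≤s) renaming (_+_ to _+ℕ_)
open import Data.Rational using (ℚ; 0ℚ; 1ℚ; _+_; _*_; -_)
open import Data.Rational.Properties
  using (+-*-commutativeRing; _≟_; *-zeroʳ; *-zeroˡ; *-identityˡ; *-identityʳ; +-identityʳ; +-identityˡ;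
         +-assoc; +-inverseʳ; *-distribʳ-+; neg-distrib-+)
open import Data.List using (List; []; _∷_; _++_; map; concatMap; upTo)
open import Data.List.Properties using (map-upTo)
open import Data.Nat.Properties using (+-comm; +-suc)
open import Data.Nat.GeneralisedArithmetic using (fold; fold-+)
open import Data.Product using (_×_; _,_)
open import Data.Bool using (Bool; true; false; if_then_else_)
open import Relation.Nullary.Decidable using (dec⇒maybe)
open import Function using (const; _∘_)
open import Relation.Binary.PropositionalEquality
open import Relation.Binary.Bundles using (Setoid)
import Relation.Binary.Reasoning.Setoid as SetoidReasoning
open import Tactic.RingSolver using (solve-∀)
open import Tactic.RingSolver.Core.AlmostCommutativeRing using (AlmostCommutativeRing; fromCommutativeRing)

ℚ-ring : AlmostCommutativeRing _ _
ℚ-ring = fromCommutativeRing +-*-commutativeRing (λ q → dec⇒maybe (0ℚ ≟ q))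

Series : Set
Series = Word → ℚ

infixl 6 _⊕_ _⊖_
infixr 8 _·_
infix  8 ⊝_

_⊕_ _⊖_ : Series → Series → Series
(f ⊕ g) w = f w + g w
(f ⊖ g) w = f w + - g w

⊝_ : Series → Series
(⊝ f) w = - f w

_·_ : ℚ → Series → Series
(c · f) w = c * f w

𝟘 : Series
𝟘 _ = 0ℚ

open Setoid (Word →-setoid ℚ) public
  using () renaming (refl to ≗-refl; sym to ≗-sym; trans to ≗-trans)
module ≗-Reasoning = SetoidReasoning (Word →-setoid ℚ)

𝟙 : Series
𝟙 []      = 1ℚ
𝟙 (_ ∷ _) = 0ℚ

δ : Word → Series
δ v w = if wordEq v w then 1ℚ else 0ℚ

-- Words are stored reversed, so R[ p ] f is f times the sum of the letters satisfying p.
R[_] : (Letter → Bool) → Series → Series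
R[ p ] f []      = 0ℚ
R[ p ] f (b ∷ w) = if p b then f w else 0ℚ

R : Letter → Series → Series
R a = R[ letterEq a ]

Rx+y : Series → Series
Rx+y = R[ const true ]

R⁻¹ : Letter → Series → Series
R⁻¹ a f w = f (a ∷ w)

other : Letter → Letter
other x = y
other y = x

𝕪 : Series
𝕪 = R y 𝟙

⊕-cong : ∀ {f f′ g g′} → f ≗ f′ → g ≗ g′ → f ⊕ g ≗ f′ ⊕ g′
⊕-cong f≗f′ g≗g′ w = cong₂ _+_ (f≗f′ w) (g≗g′ w)

⊕-congˡ : ∀ f {g g′} → g ≗ g′ → f ⊕ g ≗ f ⊕ g′
⊕-congˡ f = ⊕-cong {f} (λ _ → refl)

⊕-congʳ : ∀ {f f′} g → f ≗ f′ → f ⊕ g ≗ f′ ⊕ g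
⊕-congʳ g f≗f′ = ⊕-cong f≗f′ (λ _ → refl)

⊝-cong : ∀ {f f′} → f ≗ f′ → ⊝ f ≗ ⊝ f′
⊝-cong f≗f′ w = cong -_ (f≗f′ w)

⊖-cong : ∀ {f f′ g g′} → f ≗ f′ → g ≗ g′ → f ⊖ g ≗ f′ ⊖ g′
⊖-cong f≗f′ g≗g′ = ⊕-cong f≗f′ (⊝-cong g≗g′)

⊖-congˡ : ∀ f {g g′} → g ≗ g′ → f ⊖ g ≗ f ⊖ g′
⊖-congˡ f g≗g′ = ⊕-congˡ f (⊝-cong g≗g′)

⊖-congʳ : ∀ {f f′} g → f ≗ f′ → f ⊖ g ≗ f′ ⊖ g
⊖-congʳ g = ⊕-congʳ (⊝ g)

·-cong : ∀ c {f g} → f ≗ g → c · f ≗ c · g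
·-cong c f≗g w = cong (c *_) (f≗g w)

·-identity : ∀ f → 1ℚ · f ≗ f
·-identity f w = *-identityˡ (f w)

·-zero : ∀ f → 0ℚ · f ≗ 𝟘
·-zero f w = *-zeroˡ (f w)

⊝-as-· : ∀ f → ⊝ f ≗ (- 1ℚ) · f
⊝-as-· f w = lemma (f w)
  where
  lemma : ∀ a → - a ≡ - 1ℚ * a
  lemma = solve-∀ ℚ-ring

R[]-cong : ∀ p {f g} → f ≗ g → R[ p ] f ≗ R[ p ] g
R[]-cong p f≗g []      = refl
R[]-cong p f≗g (b ∷ w) with p b
... | true  = f≗g w
... | false = refl

R[]-map₂ : ∀ p (h : ℚ → ℚ → ℚ) → h 0ℚ 0ℚ ≡ 0ℚ →
           ∀ f g → R[ p ] (λ w → h (f w) (g w)) ≗ λ w → h (R[ p ] f w) (R[ p ] g w)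
R[]-map₂ p h h00 f g []      = sym h00
R[]-map₂ p h h00 f g (b ∷ w) with p b
... | true  = refl
... | false = sym h00

R[]-⊕ : ∀ p f g → R[ p ] (f ⊕ g) ≗ R[ p ] f ⊕ R[ p ] g
R[]-⊕ p = R[]-map₂ p _+_ refl

R[]-⊖ : ∀ p f g → R[ p ] (f ⊖ g) ≗ R[ p ] f ⊖ R[ p ] g
R[]-⊖ p = R[]-map₂ p (λ a b → a + - b) refl

R[]-⊝ : ∀ p f → R[ p ] (⊝ f) ≗ ⊝ R[ p ] f
R[]-⊝ p f = R[]-map₂ p (λ a _ → - a) refl f 𝟘

R[]-· : ∀ p c f → R[ p ] (c · f) ≗ c · R[ p ] f
R[]-· p c f = R[]-map₂ p (λ _ b → c * b) (*-zeroʳ c) 𝟘 f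

R[]-linear : ∀ p c d f g → R[ p ] (c · f ⊕ d · g) ≗ c · R[ p ] f ⊕ d · R[ p ] g
R[]-linear p c d = R[]-map₂ p (λ a b → c * a + d * b) (cong₂ _+_ (*-zeroʳ c) (*-zeroʳ d))

R[]-𝟘 : ∀ p → R[ p ] 𝟘 ≗ 𝟘
R[]-𝟘 p = R[]-map₂ p (λ _ _ → 0ℚ) refl 𝟘 𝟘

twist : Letter → Series → Series
twist a f = R (other a) (R⁻¹ (other a) f ⊖ R⁻¹ a f)

-- Writing f = f[] + Σₐ (R⁻¹ a f) a, the coefficient of w a in f ⋄ g is read off
-- from the defining rules of ⋄.
infixl 7 _⋄_
_⋄_ : Series → Series → Series
(f ⋄ g) []      = f [] * g []
(f ⋄ g) (a ∷ w) = f [] * g (a ∷ w) + (R⁻¹ a f ⋄ g) w + (twist a f ⋄ R⁻¹ a g) w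

⋄-cong : ∀ {f f′ g g′} → f ≗ f′ → g ≗ g′ → f ⋄ g ≗ f′ ⋄ g′
⋄-cong f≗f′ g≗g′ []      = cong₂ _*_ (f≗f′ []) (g≗g′ [])
⋄-cong f≗f′ g≗g′ (a ∷ w) =
  cong₂ _+_ (cong₂ _+_ (cong₂ _*_ (f≗f′ []) (g≗g′ (a ∷ w)))
                       (⋄-cong (λ v → f≗f′ (a ∷ v)) g≗g′ w))
            (⋄-cong (R[]-cong _ (⊖-cong (λ v → f≗f′ (other a ∷ v)) (λ v → f≗f′ (a ∷ v))))
                    (λ v → g≗g′ (a ∷ v)) w)

⋄-congˡ : ∀ f {g g′} → g ≗ g′ → f ⋄ g ≗ f ⋄ g′
⋄-congˡ f = ⋄-cong {f} (λ _ → refl)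

⋄-congʳ : ∀ {f f′} g → f ≗ f′ → f ⋄ g ≗ f′ ⋄ g
⋄-congʳ g f≗f′ = ⋄-cong f≗f′ (λ _ → refl)

⋄-linearˡ : ∀ c d f g h → (c · f ⊕ d · g) ⋄ h ≗ c · (f ⋄ h) ⊕ d · (g ⋄ h)
⋄-linearˡ c d f g h []      = lemma c d (f []) (g []) (h [])
  where
  lemma : ∀ c d f g h → (c * f + d * g) * h ≡ c * (f * h) + d * (g * h)
  lemma = solve-∀ ℚ-ring
⋄-linearˡ c d f g h (a ∷ w) = begin
  (c * f [] + d * g []) * h (a ∷ w) + ((c · f ⊕ d · g) ′ ⋄ h) w + (twist a (c · f ⊕ d · g) ⋄ h ′) w
    ≡⟨ cong₂ (λ s t → (c * f [] + d * g []) * h (a ∷ w) + s + t)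
         (⋄-linearˡ c d (f ′) (g ′) h w)
         (trans (⋄-congʳ (h ′) twist-linear w) (⋄-linearˡ c d (twist a f) (twist a g) (h ′) w)) ⟩
  (c * f [] + d * g []) * h (a ∷ w) + (c * (f ′ ⋄ h) w + d * (g ′ ⋄ h) w)
    + (c * (twist a f ⋄ h ′) w + d * (twist a g ⋄ h ′) w)
    ≡⟨ lemma c d (f []) (g []) (h (a ∷ w)) _ _ _ _ ⟩
  c * (f ⋄ h) (a ∷ w) + d * (g ⋄ h) (a ∷ w) ∎
  where
  open ≡-Reasoning
  _′ : Series → Series
  f ′ = R⁻¹ a f
  twist-linear : twist a (c · f ⊕ d · g) ≗ c · twist a f ⊕ d · twist a g
  twist-linear = ≗-trans (R[]-cong _ regroup) (R[]-linear _ c d _ _)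
    where
    regroup : R⁻¹ (other a) (c · f ⊕ d · g) ⊖ R⁻¹ a (c · f ⊕ d · g)
              ≗ c · (R⁻¹ (other a) f ⊖ f ′) ⊕ d · (R⁻¹ (other a) g ⊖ g ′)
    regroup w = lemma c d (f (other a ∷ w)) (g (other a ∷ w)) (f (a ∷ w)) (g (a ∷ w))
      where
      lemma : ∀ c d f₁ g₁ f₂ g₂ →
              c * f₁ + d * g₁ + - (c * f₂ + d * g₂) ≡ c * (f₁ + - f₂) + d * (g₁ + - g₂)
      lemma = solve-∀ ℚ-ring
  lemma : ∀ c d f g h s₁ t₁ s₂ t₂ →
          (c * f + d * g) * h + (c * s₁ + d * t₁) + (c * s₂ + d * t₂)
          ≡ c * (f * h + s₁ + s₂) + d * (g * h + t₁ + t₂)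
  lemma = solve-∀ ℚ-ring

⋄-linearʳ : ∀ c d f g h → f ⋄ (c · g ⊕ d · h) ≗ c · (f ⋄ g) ⊕ d · (f ⋄ h)
⋄-linearʳ c d f g h []      = lemma c d (f []) (g []) (h [])
  where
  lemma : ∀ c d f g h → f * (c * g + d * h) ≡ c * (f * g) + d * (f * h)
  lemma = solve-∀ ℚ-ring
⋄-linearʳ c d f g h (a ∷ w) =
  trans (cong₂ (λ s t → f [] * (c * g (a ∷ w) + d * h (a ∷ w)) + s + t)
               (⋄-linearʳ c d (R⁻¹ a f) g h w) (⋄-linearʳ c d (twist a f) (R⁻¹ a g) (R⁻¹ a h) w))
        (lemma c d (f []) (g (a ∷ w)) (h (a ∷ w)) _ _ _ _)
  where
  lemma : ∀ c d f g h s₁ t₁ s₂ t₂ →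
          f * (c * g + d * h) + (c * s₁ + d * t₁) + (c * s₂ + d * t₂)
          ≡ c * (f * g + s₁ + s₂) + d * (f * h + t₁ + t₂)
  lemma = solve-∀ ℚ-ring

module _ (f g h : Series) where
  open ≗-Reasoning

  ⋄-distribʳ-⊕ : (f ⊕ g) ⋄ h ≗ f ⋄ h ⊕ g ⋄ h
  ⋄-distribʳ-⊕ = begin
    (f ⊕ g) ⋄ h                 ≈⟨ ⋄-congʳ h (⊕-cong (≗-sym (·-identity f)) (≗-sym (·-identity g))) ⟩
    (1ℚ · f ⊕ 1ℚ · g) ⋄ h       ≈⟨ ⋄-linearˡ 1ℚ 1ℚ f g h ⟩
    1ℚ · (f ⋄ h) ⊕ 1ℚ · (g ⋄ h) ≈⟨ ⊕-cong (·-identity (f ⋄ h)) (·-identity (g ⋄ h)) ⟩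
    f ⋄ h ⊕ g ⋄ h               ∎

  ⋄-distribʳ-⊖ : (f ⊖ g) ⋄ h ≗ f ⋄ h ⊖ g ⋄ h
  ⋄-distribʳ-⊖ = begin
    (f ⊖ g) ⋄ h                    ≈⟨ ⋄-cong (⊕-cong (≗-sym (·-identity f)) (⊝-as-· g)) ≗-refl ⟩
    (1ℚ · f ⊕ (- 1ℚ) · g) ⋄ h        ≈⟨ ⋄-linearˡ 1ℚ (- 1ℚ) f g h ⟩
    1ℚ · (f ⋄ h) ⊕ (- 1ℚ) · (g ⋄ h)  ≈⟨ ⊕-cong (·-identity (f ⋄ h)) (≗-sym (⊝-as-· (g ⋄ h))) ⟩
    f ⋄ h ⊖ g ⋄ h                  ∎

  ⋄-distribˡ-⊕ : f ⋄ (g ⊕ h) ≗ f ⋄ g ⊕ f ⋄ h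
  ⋄-distribˡ-⊕ = begin
    f ⋄ (g ⊕ h)                 ≈⟨ ⋄-congˡ f (⊕-cong (≗-sym (·-identity g)) (≗-sym (·-identity h))) ⟩
    f ⋄ (1ℚ · g ⊕ 1ℚ · h)       ≈⟨ ⋄-linearʳ 1ℚ 1ℚ f g h ⟩
    1ℚ · (f ⋄ g) ⊕ 1ℚ · (f ⋄ h) ≈⟨ ⊕-cong (·-identity (f ⋄ g)) (·-identity (f ⋄ h)) ⟩
    f ⋄ g ⊕ f ⋄ h               ∎

module _ (c : ℚ) (f g : Series) where
  open ≗-Reasoning

  private
    drop-zero : ∀ h → c · h ⊕ 0ℚ · h ≗ c · h
    drop-zero h w = lemma c (h w)
      where
      lemma : ∀ c a → c * a + 0ℚ * a ≡ c * a
      lemma = solve-∀ ℚ-ring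

  ⋄-·ˡ : (c · f) ⋄ g ≗ c · (f ⋄ g)
  ⋄-·ˡ = begin
    (c · f) ⋄ g                  ≈⟨ ⋄-cong (≗-sym (drop-zero f)) ≗-refl ⟩
    (c · f ⊕ 0ℚ · f) ⋄ g         ≈⟨ ⋄-linearˡ c 0ℚ f f g ⟩
    c · (f ⋄ g) ⊕ 0ℚ · (f ⋄ g)   ≈⟨ drop-zero (f ⋄ g) ⟩
    c · (f ⋄ g)                  ∎

  ⋄-·ʳ : f ⋄ (c · g) ≗ c · (f ⋄ g)
  ⋄-·ʳ = begin
    f ⋄ (c · g)                  ≈⟨ ⋄-cong ≗-refl (≗-sym (drop-zero g)) ⟩
    f ⋄ (c · g ⊕ 0ℚ · g)         ≈⟨ ⋄-linearʳ c 0ℚ f g g ⟩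
    c · (f ⋄ g) ⊕ 0ℚ · (f ⋄ g)   ≈⟨ drop-zero (f ⋄ g) ⟩
    c · (f ⋄ g)                  ∎

⋄-zeroˡ : ∀ f → 𝟘 ⋄ f ≗ 𝟘
⋄-zeroˡ f = ≗-trans (⋄-congʳ f (≗-sym (·-zero 𝟘))) (≗-trans (⋄-·ˡ 0ℚ 𝟘 f) (·-zero (𝟘 ⋄ f)))

⋄-zeroʳ : ∀ f → f ⋄ 𝟘 ≗ 𝟘
⋄-zeroʳ f = ≗-trans (⋄-congˡ f (≗-sym (·-zero 𝟘))) (≗-trans (⋄-·ʳ 0ℚ f 𝟘) (·-zero (f ⋄ 𝟘)))

⋄-identityˡ : ∀ f → 𝟙 ⋄ f ≗ f
⋄-identityˡ f []      = *-identityˡ (f [])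
⋄-identityˡ f (a ∷ w) =
  trans (cong₂ (λ s t → 1ℚ * f (a ∷ w) + s + t)
               (⋄-zeroˡ f w)
               (trans (⋄-cong (R[]-𝟘 _) ≗-refl w) (⋄-zeroˡ (R⁻¹ a f) w)))
        (lemma (f (a ∷ w)))
  where
  lemma : ∀ a → 1ℚ * a + 0ℚ + 0ℚ ≡ a
  lemma = solve-∀ ℚ-ring

⋄-identityʳ : ∀ f → f ⋄ 𝟙 ≗ f
⋄-identityʳ f []      = *-identityʳ (f [])
⋄-identityʳ f (a ∷ w) =
  trans (cong₂ (λ s t → f [] * 0ℚ + s + t) (⋄-identityʳ (R⁻¹ a f) w) (⋄-zeroʳ _ w))
        (lemma (f []) (f (a ∷ w)))
  where
  lemma : ∀ a b → a * 0ℚ + b + 0ℚ ≡ b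
  lemma = solve-∀ ℚ-ring

module _ where
  private
    same-at-ā : ∀ (F G : Series) w → 0ℚ * 0ℚ + (𝟘 ⋄ F) w + (G ⋄ 𝟘) w ≡ 0ℚ
    same-at-ā F G w = cong₂ (λ s t → 0ℚ * 0ℚ + s + t) (⋄-zeroˡ F w) (⋄-zeroʳ G w)

    R-𝟘⊖ : ∀ b (P : Series) → R b (𝟘 ⊖ P) ≗ 𝟘 ⊖ R b P
    R-𝟘⊖ b P = ≗-trans (R[]-⊖ _ 𝟘 P) (⊖-congʳ (R b P) (R[]-𝟘 _))

    R-⊖𝟘 : ∀ b (P : Series) → R b (P ⊖ 𝟘) ≗ R b P
    R-⊖𝟘 b P = R[]-cong _ (λ w → +-identityʳ (P w))

    same-at-a : ∀ a (P Q : Series) w →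
           0ℚ * Q w + (P ⋄ R a Q) w + (R (other a) (𝟘 ⊖ P) ⋄ Q) w
           ≡ (P ⋄ R a Q ⊖ R (other a) P ⋄ Q) w
    same-at-a a P Q w =
      trans (cong (λ t → 0ℚ * Q w + (P ⋄ R a Q) w + t)
                  (trans (⋄-congʳ Q (R-𝟘⊖ (other a) P) w)
                         (trans (⋄-distribʳ-⊖ 𝟘 (R (other a) P) Q w)
                                (cong (_+ - (R (other a) P ⋄ Q) w) (⋄-zeroˡ Q w)))))
            (lemma (Q w) _ _)
      where
      lemma : ∀ q s t → 0ℚ * q + s + (0ℚ + - t) ≡ s + - t
      lemma = solve-∀ ℚ-ring

    other-at-a : ∀ (F G : Series) w → 0ℚ * 0ℚ + F w + (G ⋄ 𝟘) w ≡ F w + 0ℚ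
    other-at-a F G w = trans (cong (λ t → 0ℚ * 0ℚ + F w + t) (⋄-zeroʳ G w)) (lemma (F w))
      where
      lemma : ∀ s → 0ℚ * 0ℚ + s + 0ℚ ≡ s + 0ℚ
      lemma = solve-∀ ℚ-ring

    other-at-ā : ∀ b (P Q F : Series) w →
                   0ℚ * Q w + (𝟘 ⋄ F) w + (R b (P ⊖ 𝟘) ⋄ Q) w ≡ 0ℚ + (R b P ⋄ Q) w
    other-at-ā b P Q F w =
      trans (cong₂ (λ s t → 0ℚ * Q w + s + t) (⋄-zeroˡ F w) (⋄-congʳ Q (R-⊖𝟘 b P) w))
            (lemma (Q w) _)
      where
      lemma : ∀ q t → 0ℚ * q + 0ℚ + t ≡ 0ℚ + t
      lemma = solve-∀ ℚ-ring

  ⋄-R-same : ∀ a (P Q : Series) → R a P ⋄ R a Q ≗ R a (P ⋄ R a Q ⊖ R (other a) P ⋄ Q)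
  ⋄-R-same x P Q []      = refl
  ⋄-R-same x P Q (x ∷ w) = same-at-a x P Q w
  ⋄-R-same x P Q (y ∷ w) = same-at-ā (R x Q) (R x (P ⊖ 𝟘)) w
  ⋄-R-same y P Q []      = refl
  ⋄-R-same y P Q (x ∷ w) = same-at-ā (R y Q) (R y (P ⊖ 𝟘)) w
  ⋄-R-same y P Q (y ∷ w) = same-at-a y P Q w

  ⋄-R-other : ∀ a (P Q : Series) →
              R a P ⋄ R (other a) Q ≗ R a (P ⋄ R (other a) Q) ⊕ R (other a) (R a P ⋄ Q)
  ⋄-R-other x P Q []      = refl
  ⋄-R-other x P Q (x ∷ w) = other-at-a (P ⋄ R y Q) (R y (𝟘 ⊖ P)) w
  ⋄-R-other x P Q (y ∷ w) = other-at-ā x P Q (R y Q) w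
  ⋄-R-other y P Q []      = refl
  ⋄-R-other y P Q (x ∷ w) = other-at-ā y P Q (R x Q) w
  ⋄-R-other y P Q (y ∷ w) = other-at-a (P ⋄ R x Q) (R x (𝟘 ⊖ P)) w

R-other : ∀ a P → R (other a) P ≗ Rx+y P ⊖ R a P
R-other x P []      = refl
R-other x P (x ∷ w) = sym (+-inverseʳ (P w))
R-other x P (y ∷ w) = sym (+-identityʳ (P w))
R-other y P []      = refl
R-other y P (x ∷ w) = sym (+-identityʳ (P w))
R-other y P (y ∷ w) = sym (+-inverseʳ (P w))

module _ where
  private
    empty : ∀ p → p ≡ p * 1ℚ + 0ℚ + 0ℚ
    empty = solve-∀ ℚ-ring

    same-at-a : ∀ p q → q ≡ p * 0ℚ + q + 0ℚ
    same-at-a = solve-∀ ℚ-ring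

    different : ∀ p q r → r ≡ p * 0ℚ + q + (r + - q)
    different = solve-∀ ℚ-ring

  decompose : ∀ a P → P ≗ P [] · 𝟙 ⊕ Rx+y (R⁻¹ a P) ⊕ twist a P
  decompose a P []      = empty (P [])
  decompose x P (x ∷ w) = same-at-a (P []) (P (x ∷ w))
  decompose x P (y ∷ w) = different (P []) (P (x ∷ w)) (P (y ∷ w))
  decompose y P (x ∷ w) = different (P []) (P (y ∷ w)) (P (x ∷ w))
  decompose y P (y ∷ w) = same-at-a (P []) (P (y ∷ w))

Rx+y-⋄ : ∀ P Q → Rx+y P ⋄ Q ≗ Rx+y (P ⋄ Q)
Rx+y-⋄ P Q []      = *-zeroˡ (Q [])
Rx+y-⋄ P Q (a ∷ w) =
  trans (cong (λ t → 0ℚ * Q (a ∷ w) + (P ⋄ Q) w + t)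
              (trans (⋄-congʳ (R⁻¹ a Q) (≗-trans (R[]-cong _ (λ v → +-inverseʳ (P v))) (R[]-𝟘 _)) w)
                     (⋄-zeroˡ (R⁻¹ a Q) w)))
        (lemma (Q (a ∷ w)) ((P ⋄ Q) w))
  where
  lemma : ∀ q s → 0ℚ * q + s + 0ℚ ≡ s
  lemma = solve-∀ ℚ-ring

⋄-decompose : ∀ a P Q →
  P ⋄ Q ≗ P [] · Q ⊕ Rx+y (R⁻¹ a P ⋄ Q) ⊕ twist a P ⋄ Q
⋄-decompose a P Q = begin
  P ⋄ Q
    ≈⟨ ⋄-cong (decompose a P) ≗-refl ⟩
  (P [] · 𝟙 ⊕ Rx+y (R⁻¹ a P) ⊕ twist a P) ⋄ Q
    ≈⟨ ⋄-distribʳ-⊕ (P [] · 𝟙 ⊕ Rx+y (R⁻¹ a P)) (twist a P) Q ⟩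
  (P [] · 𝟙 ⊕ Rx+y (R⁻¹ a P)) ⋄ Q ⊕ twist a P ⋄ Q
    ≈⟨ ⊕-congʳ (twist a P ⋄ Q) (⋄-distribʳ-⊕ (P [] · 𝟙) (Rx+y (R⁻¹ a P)) Q) ⟩
  P [] · 𝟙 ⋄ Q ⊕ Rx+y (R⁻¹ a P) ⋄ Q ⊕ twist a P ⋄ Q
    ≈⟨ ⊕-congʳ (twist a P ⋄ Q) (⊕-cong (≗-trans (⋄-·ˡ (P []) 𝟙 Q) (·-cong (P []) (⋄-identityˡ Q)))
                                (Rx+y-⋄ (R⁻¹ a P) Q)) ⟩
  P [] · Q ⊕ Rx+y (R⁻¹ a P ⋄ Q) ⊕ twist a P ⋄ Q ∎
  where
  open ≗-Reasoning

⋄-Rx+y : ∀ P Q → P ⋄ Rx+y Q ≗ Rx+y (P ⋄ Q)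
⋄-Rx+y P Q []      = *-zeroʳ (P [])
⋄-Rx+y P Q (a ∷ w) = begin
  P [] * Q w + (R⁻¹ a P ⋄ Rx+y Q) w + (twist a P ⋄ Q) w
    ≡⟨ cong (λ t → P [] * Q w + t + (twist a P ⋄ Q) w) (⋄-Rx+y (R⁻¹ a P) Q w) ⟩
  P [] * Q w + Rx+y (R⁻¹ a P ⋄ Q) w + (twist a P ⋄ Q) w
    ≡⟨ ⋄-decompose a P Q w ⟨
  (P ⋄ Q) w ∎
  where
  open ≡-Reasoning

⋄-R-R : ∀ a P Q → R a P ⋄ R a Q ≗ R a (P ⋄ R a Q ⊕ R a P ⋄ Q ⊖ Rx+y (P ⋄ Q))
⋄-R-R a P Q = begin
  R a P ⋄ R a Q                                        ≈⟨ ⋄-R-same a P Q ⟩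
  R a (P ⋄ R a Q ⊖ R (other a) P ⋄ Q)                  ≈⟨ R[]-cong _ (⊖-congˡ (P ⋄ R a Q) other-term) ⟩
  R a (P ⋄ R a Q ⊖ (Rx+y (P ⋄ Q) ⊖ R a P ⋄ Q))
    ≈⟨ R[]-cong _ (regroup (P ⋄ R a Q) (Rx+y (P ⋄ Q)) (R a P ⋄ Q)) ⟩
  R a (P ⋄ R a Q ⊕ R a P ⋄ Q ⊖ Rx+y (P ⋄ Q))           ∎
  where
  open ≗-Reasoning
  other-term : R (other a) P ⋄ Q ≗ Rx+y (P ⋄ Q) ⊖ R a P ⋄ Q
  other-term = begin
    R (other a) P ⋄ Q            ≈⟨ ⋄-cong (R-other a P) ≗-refl ⟩
    (Rx+y P ⊖ R a P) ⋄ Q         ≈⟨ ⋄-distribʳ-⊖ (Rx+y P) (R a P) Q ⟩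
    Rx+y P ⋄ Q ⊖ R a P ⋄ Q       ≈⟨ ⊖-congʳ (R a P ⋄ Q) (Rx+y-⋄ P Q) ⟩
    Rx+y (P ⋄ Q) ⊖ R a P ⋄ Q     ∎
  regroup : ∀ f g h → f ⊖ (g ⊖ h) ≗ f ⊕ h ⊖ g
  regroup f g h w = lemma (f w) (g w) (h w)
    where
    lemma : ∀ a b c → a + - (b + - c) ≡ a + c + - b
    lemma = solve-∀ ℚ-ring

⋄-𝕪-comm : ∀ f → f ⋄ 𝕪 ≗ 𝕪 ⋄ f
⋄-𝕪-comm f []      = trans (*-zeroʳ (f [])) (sym (*-zeroˡ (f [])))
⋄-𝕪-comm f (a ∷ w) =
  trans (right (a ∷ w))
        (trans (cong₂ (λ s t → f [] * 𝕪 (a ∷ w) + s + t) (⋄-𝕪-comm fx w) (y-part a))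
               (sym (left (a ∷ w))))
  where
  open ≗-Reasoning
  fx fb : Series
  fx = R⁻¹ x f
  fb = R⁻¹ y f ⊖ R⁻¹ x f

  y-part : ∀ a → R y (fb ⋄ 𝕪 ⊕ R y fb ⊖ Rx+y fb) (a ∷ w)
               ≡ R y (R y fb ⊕ 𝕪 ⋄ fb ⊖ Rx+y fb) (a ∷ w)
  y-part x = refl
  y-part y = trans (cong (λ t → t + R y fb w + - Rx+y fb w) (⋄-𝕪-comm fb w))
                   (lemma ((𝕪 ⋄ fb) w) (R y fb w) (Rx+y fb w))
    where
    lemma : ∀ s t u → s + t + - u ≡ t + s + - u
    lemma = solve-∀ ℚ-ring

  right : f ⋄ 𝕪 ≗ f [] · 𝕪 ⊕ Rx+y (fx ⋄ 𝕪) ⊕ R y (fb ⋄ 𝕪 ⊕ R y fb ⊖ Rx+y fb)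
  right = begin
    f ⋄ 𝕪
      ≈⟨ ⋄-decompose x f 𝕪 ⟩
    f [] · 𝕪 ⊕ Rx+y (fx ⋄ 𝕪) ⊕ R y fb ⋄ R y 𝟙
      ≈⟨ ⊕-congˡ (f [] · 𝕪 ⊕ Rx+y (fx ⋄ 𝕪)) (⋄-R-R y fb 𝟙) ⟩
    f [] · 𝕪 ⊕ Rx+y (fx ⋄ 𝕪) ⊕ R y (fb ⋄ 𝕪 ⊕ R y fb ⋄ 𝟙 ⊖ Rx+y (fb ⋄ 𝟙))
      ≈⟨ ⊕-congˡ (f [] · 𝕪 ⊕ Rx+y (fx ⋄ 𝕪))
           (R[]-cong _ (⊖-cong (⊕-congˡ (fb ⋄ 𝕪) (⋄-identityʳ (R y fb))) (R[]-cong _ (⋄-identityʳ fb)))) ⟩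
    f [] · 𝕪 ⊕ Rx+y (fx ⋄ 𝕪) ⊕ R y (fb ⋄ 𝕪 ⊕ R y fb ⊖ Rx+y fb) ∎

  left : 𝕪 ⋄ f ≗ f [] · 𝕪 ⊕ Rx+y (𝕪 ⋄ fx) ⊕ R y (R y fb ⊕ 𝕪 ⋄ fb ⊖ Rx+y fb)
  left = begin
    𝕪 ⋄ f
      ≈⟨ ⋄-congˡ 𝕪 (decompose x f) ⟩
    𝕪 ⋄ (f [] · 𝟙 ⊕ Rx+y fx ⊕ R y fb)
      ≈⟨ ⋄-distribˡ-⊕ 𝕪 (f [] · 𝟙 ⊕ Rx+y fx) (R y fb) ⟩
    𝕪 ⋄ (f [] · 𝟙 ⊕ Rx+y fx) ⊕ 𝕪 ⋄ R y fb
      ≈⟨ ⊕-congʳ (𝕪 ⋄ R y fb) (⋄-distribˡ-⊕ 𝕪 (f [] · 𝟙) (Rx+y fx)) ⟩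
    𝕪 ⋄ f [] · 𝟙 ⊕ 𝕪 ⋄ Rx+y fx ⊕ 𝕪 ⋄ R y fb
      ≈⟨ ⊕-cong (⊕-cong (≗-trans (⋄-·ʳ (f []) 𝕪 𝟙) (·-cong (f []) (⋄-identityʳ 𝕪)))
                        (⋄-Rx+y 𝕪 fx))
                (⋄-R-R y 𝟙 fb) ⟩
    f [] · 𝕪 ⊕ Rx+y (𝕪 ⋄ fx) ⊕ R y (𝟙 ⋄ R y fb ⊕ 𝕪 ⋄ fb ⊖ Rx+y (𝟙 ⋄ fb))
      ≈⟨ ⊕-congˡ (f [] · 𝕪 ⊕ Rx+y (𝕪 ⋄ fx))
           (R[]-cong _ (⊖-cong (⊕-congʳ (𝕪 ⋄ fb) (⋄-identityˡ (R y fb))) (R[]-cong _ (⋄-identityˡ fb)))) ⟩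
    f [] · 𝕪 ⊕ Rx+y (𝕪 ⋄ fx) ⊕ R y (R y fb ⊕ 𝕪 ⋄ fb ⊖ Rx+y fb) ∎

∑ : {A : Set} → List A → (A → Series) → Series
∑ []       f = 𝟘
∑ (a ∷ as) f = f a ⊕ ∑ as f

syntax ∑ as (λ a → e) = ∑[ a ∈ as ] e

∑-cong : ∀ {A : Set} (as : List A) {f g : A → Series} → (∀ a → f a ≗ g a) → ∑ as f ≗ ∑ as g
∑-cong []       f≗g = ≗-refl
∑-cong (a ∷ as) f≗g = ⊕-cong (f≗g a) (∑-cong as f≗g)

∑-++ : ∀ {A : Set} (as bs : List A) (f : A → Series) → ∑ (as ++ bs) f ≗ ∑ as f ⊕ ∑ bs f
∑-++ []       bs f w = sym (+-identityˡ (∑ bs f w))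
∑-++ (a ∷ as) bs f w = trans (cong (f a w +_) (∑-++ as bs f w)) (sym (+-assoc (f a w) _ _))

∑-⊝ : ∀ {A : Set} (as : List A) f → ∑[ a ∈ as ] (⊝ f a) ≗ ⊝ ∑ as f
∑-⊝ []       f w = refl
∑-⊝ (a ∷ as) f w = trans (cong (- f a w +_) (∑-⊝ as f w)) (sym (neg-distrib-+ (f a w) (∑ as f w)))

∑-map : ∀ {A B : Set} (h : A → B) as (f : B → Series) → ∑ (map h as) f ≡ ∑[ a ∈ as ] f (h a)
∑-map h []       f = refl
∑-map h (a ∷ as) f = cong (f (h a) ⊕_) (∑-map h as f)

∑-upTo-suc : ∀ n (f : ℕ → Series) → ∑ (upTo (suc n)) f ≗ f 0 ⊕ ∑[ j ∈ upTo n ] f (suc j)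
∑-upTo-suc n f w =
  cong (λ g → f 0 w + g w) (trans (cong (λ js → ∑ js f) (sym (map-upTo suc n))) (∑-map suc (upTo n) f))

∑-concatMap : ∀ {A B : Set} (F : A → List B) as (g : B → Series) →
              ∑ (concatMap F as) g ≗ ∑[ a ∈ as ] ∑ (F a) g
∑-concatMap F []       g = ≗-refl
∑-concatMap F (a ∷ as) g = ≗-trans (∑-++ (F a) (concatMap F as) g) (⊕-congˡ (∑ (F a) g) (∑-concatMap F as g))

∑∑-corner : ∀ m n (β γ : ℕ → ℕ → Series) c →
  β 0 0 ≗ γ 0 0 ⊖ c → (∀ j → β 0 (suc j) ≗ γ 0 (suc j)) → (∀ i j → β (suc i) j ≗ γ (suc i) j) →
  ∑[ i ∈ upTo (suc m) ] ∑[ j ∈ upTo (suc n) ] β i j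
  ≗ (∑[ i ∈ upTo (suc m) ] ∑[ j ∈ upTo (suc n) ] γ i j) ⊖ c
∑∑-corner m n β γ c corner first-row other-rows = begin
  ∑[ i ∈ upTo (suc m) ] ∑[ j ∈ upTo (suc n) ] β i j
    ≈⟨ ∑-upTo-suc m (λ i → ∑[ j ∈ upTo (suc n) ] β i j) ⟩
  ∑[ j ∈ upTo (suc n) ] β 0 j ⊕ ∑[ i ∈ upTo m ] ∑[ j ∈ upTo (suc n) ] β (suc i) j
    ≈⟨ ⊕-cong (≗-trans (∑-upTo-suc n (β 0)) (⊕-cong corner (∑-cong (upTo n) first-row)))
              (∑-cong (upTo m) λ i → ∑-cong (upTo (suc n)) (other-rows i)) ⟩
  (γ 0 0 ⊖ c) ⊕ ∑[ j ∈ upTo n ] γ 0 (suc j) ⊕ ∑[ i ∈ upTo m ] ∑[ j ∈ upTo (suc n) ] γ (suc i) j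
    ≈⟨ (λ w → lemma (γ 0 0 w) (c w) ((∑[ j ∈ upTo n ] γ 0 (suc j)) w)
                    ((∑[ i ∈ upTo m ] ∑[ j ∈ upTo (suc n) ] γ (suc i) j) w)) ⟩
  (γ 0 0 ⊕ ∑[ j ∈ upTo n ] γ 0 (suc j)) ⊕ ∑[ i ∈ upTo m ] ∑[ j ∈ upTo (suc n) ] γ (suc i) j ⊖ c
    ≈⟨ ⊖-congʳ c (≗-trans (⊕-congʳ (∑[ i ∈ upTo m ] ∑[ j ∈ upTo (suc n) ] γ (suc i) j)
                                    (≗-sym (∑-upTo-suc n (γ 0))))
                          (≗-sym (∑-upTo-suc m (λ i → ∑[ j ∈ upTo (suc n) ] γ i j)))) ⟩
  (∑[ i ∈ upTo (suc m) ] ∑[ j ∈ upTo (suc n) ] γ i j) ⊖ c ∎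
  where
  open ≗-Reasoning
  lemma : ∀ g c s t → g + - c + s + t ≡ g + s + t + - c
  lemma = solve-∀ ℚ-ring

monomial : ℚ × Word → Series
monomial (c , v) = c · δ v

coeff-∷ : ∀ c v p → coeff ((c , v) ∷ p) ≗ monomial (c , v) ⊕ coeff p
coeff-∷ c v p w with wordEq v w
... | true  = cong (_+ coeff p w) (sym (*-identityʳ c))
... | false = sym (trans (cong (_+ coeff p w) (*-zeroʳ c)) (+-identityˡ (coeff p w)))

coeff-as-∑ : ∀ p → coeff p ≗ ∑ p monomial
coeff-as-∑ []            = ≗-refl
coeff-as-∑ ((c , v) ∷ p) = ≗-trans (coeff-∷ c v p) (⊕-congˡ (monomial (c , v)) (coeff-as-∑ p))

coeff-++ : ∀ p q → coeff (p ++ q) ≗ coeff p ⊕ coeff q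
coeff-++ p q = ≗-trans (coeff-as-∑ (p ++ q))
                 (≗-trans (∑-++ p q monomial) (⊕-cong (≗-sym (coeff-as-∑ p)) (≗-sym (coeff-as-∑ q))))

coeff-concatMap : ∀ {A : Set} (F : A → Poly) as → coeff (concatMap F as) ≗ ∑[ a ∈ as ] coeff (F a)
coeff-concatMap F []       = ≗-refl
coeff-concatMap F (a ∷ as) = ≗-trans (coeff-++ (F a) (concatMap F as)) (⊕-congˡ (coeff (F a)) (coeff-concatMap F as))

δ-[] : δ [] ≗ 𝟙
δ-[] []      = refl
δ-[] (_ ∷ _) = refl

δ-∷ : ∀ a v → δ (a ∷ v) ≗ R a (δ v)
δ-∷ a v []      = refl
δ-∷ a v (b ∷ w) with letterEq a b
... | true  = refl
... | false = refl

coeff-single : ∀ v → coeff ((1ℚ , v) ∷ []) ≗ δ v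
coeff-single v w = trans (coeff-∷ 1ℚ v [] w) (trans (+-identityʳ _) (*-identityˡ (δ v w)))

coeff-scale : ∀ d p → coeff (scale d p) ≗ d · coeff p
coeff-scale d []            w = sym (*-zeroʳ d)
coeff-scale d ((c , v) ∷ p) w = begin
  coeff ((d * c , v) ∷ scale d p) w     ≡⟨ coeff-∷ (d * c) v (scale d p) w ⟩
  d * c * δ v w + coeff (scale d p) w   ≡⟨ cong (d * c * δ v w +_) (coeff-scale d p w) ⟩
  d * c * δ v w + d * coeff p w         ≡⟨ lemma d c (δ v w) (coeff p w) ⟩
  d * (c * δ v w + coeff p w)           ≡⟨ cong (d *_) (coeff-∷ c v p w) ⟨
  d * coeff ((c , v) ∷ p) w             ∎
  where
  open ≡-Reasoning
  lemma : ∀ d c e f → d * c * e + d * f ≡ d * (c * e + f)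
  lemma = solve-∀ ℚ-ring

coeff-neg : ∀ p → coeff (neg p) ≗ ⊝ coeff p
coeff-neg p = ≗-trans (coeff-scale (- 1ℚ) p) (≗-sym (⊝-as-· (coeff p)))

coeff-mulR : ∀ a p → coeff (mulR a p) ≗ R a (coeff p)
coeff-mulR a []            = ≗-sym (R[]-𝟘 _)
coeff-mulR a ((c , v) ∷ p) = begin
  coeff ((c , a ∷ v) ∷ mulR a p)      ≈⟨ coeff-∷ c (a ∷ v) (mulR a p) ⟩
  c · δ (a ∷ v) ⊕ coeff (mulR a p)    ≈⟨ ⊕-cong (·-cong c (δ-∷ a v)) (coeff-mulR a p) ⟩
  c · R a (δ v) ⊕ R a (coeff p)       ≈⟨ ⊕-congʳ (R a (coeff p)) (R[]-· _ c (δ v)) ⟨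
  R a (c · δ v) ⊕ R a (coeff p)       ≈⟨ R[]-⊕ _ (c · δ v) (coeff p) ⟨
  R a (c · δ v ⊕ coeff p)             ≈⟨ R[]-cong _ (coeff-∷ c v p) ⟨
  R a (coeff ((c , v) ∷ p))           ∎
  where open ≗-Reasoning

module _ where
  private
    same-letter : ∀ a v u →
      coeff (v ◇w (a ∷ u)) ≗ δ v ⋄ δ (a ∷ u) →
      coeff ((other a ∷ v) ◇w u) ≗ δ (other a ∷ v) ⋄ δ u →
      coeff (mulR a ((v ◇w (a ∷ u)) ++ neg ((other a ∷ v) ◇w u))) ≗ δ (a ∷ v) ⋄ δ (a ∷ u)
    same-letter a v u hyp₁ hyp₂ = begin
      coeff (mulR a ((v ◇w (a ∷ u)) ++ neg ((other a ∷ v) ◇w u)))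
        ≈⟨ coeff-mulR a (p ++ neg q) ⟩
      R a (coeff (p ++ neg q))
        ≈⟨ R[]-cong _ (≗-trans (coeff-++ p (neg q)) (⊕-cong hyp₁ (≗-trans (coeff-neg q) (⊝-cong hyp₂)))) ⟩
      R a (δ v ⋄ δ (a ∷ u) ⊖ δ (other a ∷ v) ⋄ δ u)
        ≈⟨ R[]-cong _ (⊖-cong (⋄-cong ≗-refl (δ-∷ a u)) (⋄-cong (δ-∷ (other a) v) ≗-refl)) ⟩
      R a (δ v ⋄ R a (δ u) ⊖ R (other a) (δ v) ⋄ δ u)
        ≈⟨ ⋄-R-same a (δ v) (δ u) ⟨
      R a (δ v) ⋄ R a (δ u)
        ≈⟨ ⋄-cong (δ-∷ a v) (δ-∷ a u) ⟨
      δ (a ∷ v) ⋄ δ (a ∷ u) ∎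
      where
      open ≗-Reasoning
      p q : Poly
      p = v ◇w (a ∷ u)
      q = (other a ∷ v) ◇w u

    other-letter : ∀ a v u →
      coeff (v ◇w (other a ∷ u)) ≗ δ v ⋄ δ (other a ∷ u) →
      coeff ((a ∷ v) ◇w u) ≗ δ (a ∷ v) ⋄ δ u →
      coeff (mulR a (v ◇w (other a ∷ u)) ++ mulR (other a) ((a ∷ v) ◇w u)) ≗ δ (a ∷ v) ⋄ δ (other a ∷ u)
    other-letter a v u hyp₁ hyp₂ = begin
      coeff (mulR a (v ◇w (other a ∷ u)) ++ mulR (other a) ((a ∷ v) ◇w u))
        ≈⟨ coeff-++ (mulR a p) (mulR (other a) q) ⟩
      coeff (mulR a p) ⊕ coeff (mulR (other a) q)
        ≈⟨ ⊕-cong (≗-trans (coeff-mulR a p) (R[]-cong _ hyp₁))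
                  (≗-trans (coeff-mulR (other a) q) (R[]-cong _ hyp₂)) ⟩
      R a (δ v ⋄ δ (other a ∷ u)) ⊕ R (other a) (δ (a ∷ v) ⋄ δ u)
        ≈⟨ ⊕-cong (R[]-cong _ (⋄-congˡ (δ v) (δ-∷ (other a) u))) (R[]-cong _ (⋄-congʳ (δ u) (δ-∷ a v))) ⟩
      R a (δ v ⋄ R (other a) (δ u)) ⊕ R (other a) (R a (δ v) ⋄ δ u)
        ≈⟨ ⋄-R-other a (δ v) (δ u) ⟨
      R a (δ v) ⋄ R (other a) (δ u)
        ≈⟨ ⋄-cong (δ-∷ a v) (δ-∷ (other a) u) ⟨
      δ (a ∷ v) ⋄ δ (other a ∷ u) ∎
      where
      open ≗-Reasoning
      p q : Poly
      p = v ◇w (other a ∷ u)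
      q = (a ∷ v) ◇w u

  coeff-◇w : ∀ v u → coeff (v ◇w u) ≗ δ v ⋄ δ u
  coeff-◇w []      u       = ≗-trans (coeff-single u)
                               (≗-sym (≗-trans (⋄-cong δ-[] ≗-refl) (⋄-identityˡ (δ u))))
  coeff-◇w (a ∷ v) []      = ≗-trans (coeff-single (a ∷ v))
                               (≗-sym (≗-trans (⋄-cong ≗-refl δ-[]) (⋄-identityʳ (δ (a ∷ v)))))
  coeff-◇w (x ∷ v) (x ∷ u) = same-letter x v u (coeff-◇w v (x ∷ u)) (coeff-◇w (y ∷ v) u)
  coeff-◇w (x ∷ v) (y ∷ u) = other-letter x v u (coeff-◇w v (y ∷ u)) (coeff-◇w (x ∷ v) u)
  coeff-◇w (y ∷ v) (x ∷ u) = other-letter y v u (coeff-◇w v (x ∷ u)) (coeff-◇w (y ∷ v) u)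
  coeff-◇w (y ∷ v) (y ∷ u) = same-letter y v u (coeff-◇w v (y ∷ u)) (coeff-◇w (x ∷ v) u)

coeff-◇ : ∀ p q → coeff (p ◇ q) ≗ coeff p ⋄ coeff q
coeff-◇ []            q = ≗-sym (⋄-zeroˡ (coeff q))
coeff-◇ ((c , v) ∷ p) q = begin
  coeff (concatMap (λ (d , u) → scale (c * d) (v ◇w u)) q ++ p ◇ q)
    ≈⟨ coeff-++ (concatMap (λ (d , u) → scale (c * d) (v ◇w u)) q) (p ◇ q) ⟩
  coeff (concatMap (λ (d , u) → scale (c * d) (v ◇w u)) q) ⊕ coeff (p ◇ q)
    ≈⟨ ⊕-cong (row q) (coeff-◇ p q) ⟩
  c · (δ v ⋄ coeff q) ⊕ coeff p ⋄ coeff q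
    ≈⟨ ⊕-congʳ (coeff p ⋄ coeff q) (⋄-·ˡ c (δ v) (coeff q)) ⟨
  c · δ v ⋄ coeff q ⊕ coeff p ⋄ coeff q
    ≈⟨ ⋄-distribʳ-⊕ (c · δ v) (coeff p) (coeff q) ⟨
  (c · δ v ⊕ coeff p) ⋄ coeff q
    ≈⟨ ⋄-cong (coeff-∷ c v p) ≗-refl ⟨
  coeff ((c , v) ∷ p) ⋄ coeff q ∎
  where
  open ≗-Reasoning
  row : ∀ q → coeff (concatMap (λ (d , u) → scale (c * d) (v ◇w u)) q) ≗ c · (δ v ⋄ coeff q)
  row []            w = trans (sym (*-zeroʳ c)) (cong (c *_) (sym (⋄-zeroʳ (δ v) w)))
  row ((d , u) ∷ q) = begin
    coeff (scale (c * d) (v ◇w u) ++ concatMap (λ (d , u) → scale (c * d) (v ◇w u)) q)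
      ≈⟨ coeff-++ (scale (c * d) (v ◇w u)) _ ⟩
    coeff (scale (c * d) (v ◇w u)) ⊕ coeff (concatMap (λ (d , u) → scale (c * d) (v ◇w u)) q)
      ≈⟨ ⊕-cong (≗-trans (coeff-scale (c * d) (v ◇w u)) (·-cong (c * d) (coeff-◇w v u))) (row q) ⟩
    (c * d) · (δ v ⋄ δ u) ⊕ c · (δ v ⋄ coeff q)
      ≈⟨ (λ w → lemma c d ((δ v ⋄ δ u) w) ((δ v ⋄ coeff q) w)) ⟩
    c · (d · (δ v ⋄ δ u) ⊕ δ v ⋄ coeff q)
      ≈⟨ ·-cong c (⊕-congʳ (δ v ⋄ coeff q) (⋄-·ʳ d (δ v) (δ u))) ⟨
    c · (δ v ⋄ d · δ u ⊕ δ v ⋄ coeff q)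
      ≈⟨ ·-cong c (⋄-distribˡ-⊕ (δ v) (d · δ u) (coeff q)) ⟨
    c · (δ v ⋄ (d · δ u ⊕ coeff q))
      ≈⟨ ·-cong c (⋄-cong ≗-refl (coeff-∷ d u q)) ⟨
    c · (δ v ⋄ coeff ((d , u) ∷ q)) ∎
    where
    lemma : ∀ c d s t → c * d * s + c * t ≡ c * (d * s + t)
    lemma = solve-∀ ℚ-ring

Rx+2y : Series → Series
Rx+2y f w = (Rx+y f ⊕ R y f) w

-- The series counterpart of B₊: F_{B₊ f} = (F_f[] + R_{x+2y} R_y⁻¹ F_f) y.
graft : Series → Series
graft f w = R y (f [] · 𝟙 ⊕ Rx+2y (R⁻¹ y f)) w

Rx+2y-cong : ∀ {f g} → f ≗ g → Rx+2y f ≗ Rx+2y g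
Rx+2y-cong f≗g = ⊕-cong (R[]-cong _ f≗g) (R[]-cong _ f≗g)

graft-cong : ∀ {f g} → f ≗ g → graft f ≗ graft g
graft-cong {f} {g} f≗g = R[]-cong _ (⊕-cong (·-cong′ (f≗g [])) (Rx+2y-cong (λ w → f≗g (y ∷ w))))
  where
  ·-cong′ : f [] ≡ g [] → f [] · 𝟙 ≗ g [] · 𝟙
  ·-cong′ eq w = cong (_* 𝟙 w) eq

graft-⊕ : ∀ f g → graft (f ⊕ g) ≗ graft f ⊕ graft g
graft-⊕ f g = ≗-trans (R[]-cong _ inner) (R[]-⊕ _ _ _)
  where
  inner : (f [] + g []) · 𝟙 ⊕ Rx+2y (R⁻¹ y f ⊕ R⁻¹ y g)
          ≗ (f [] · 𝟙 ⊕ Rx+2y (R⁻¹ y f)) ⊕ (g [] · 𝟙 ⊕ Rx+2y (R⁻¹ y g))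
  inner w = trans (cong₂ _+_ (*-distribʳ-+ (𝟙 w) (f []) (g []))
                             (cong₂ _+_ (R[]-⊕ _ (R⁻¹ y f) (R⁻¹ y g) w) (R[]-⊕ _ (R⁻¹ y f) (R⁻¹ y g) w)))
                  (lemma (f [] * 𝟙 w) (g [] * 𝟙 w) (Rx+y (R⁻¹ y f) w) (Rx+y (R⁻¹ y g) w)
                         (R y (R⁻¹ y f) w) (R y (R⁻¹ y g) w))
    where
    lemma : ∀ a b c d e h → a + b + (c + d + (e + h)) ≡ a + (c + e) + (b + (d + h))
    lemma = solve-∀ ℚ-ring

graft-⊝ : ∀ f → graft (⊝ f) ≗ ⊝ graft f
graft-⊝ f = ≗-trans (R[]-cong _ inner) (R[]-⊝ _ (f [] · 𝟙 ⊕ Rx+2y (R⁻¹ y f)))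
  where
  inner : (- f []) · 𝟙 ⊕ Rx+2y (⊝ R⁻¹ y f) ≗ ⊝ (f [] · 𝟙 ⊕ Rx+2y (R⁻¹ y f))
  inner w = trans (cong₂ (λ s t → - f [] * 𝟙 w + (s + t)) (R[]-⊝ _ (R⁻¹ y f) w) (R[]-⊝ _ (R⁻¹ y f) w))
                  (lemma (f []) (𝟙 w) (Rx+y (R⁻¹ y f) w) (R y (R⁻¹ y f) w))
    where
    lemma : ∀ a e s t → - a * e + (- s + - t) ≡ - (a * e + (s + t))
    lemma = solve-∀ ℚ-ring

graft-⊖ : ∀ f g → graft (f ⊖ g) ≗ graft f ⊖ graft g
graft-⊖ f g = ≗-trans (graft-⊕ f (⊝ g)) (⊕-congˡ (graft f) (graft-⊝ g))

graft-𝟘 : graft 𝟘 ≗ 𝟘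
graft-𝟘 = ≗-trans (R[]-cong _ (λ w → cong₂ _+_ (*-zeroˡ (𝟙 w)) (cong₂ _+_ (R[]-𝟘 _ w) (R[]-𝟘 _ w))))
                  (R[]-𝟘 _)

graft-R-y : ∀ Z → graft (R y Z) ≗ R y (Rx+2y Z)
graft-R-y Z = R[]-cong _ (λ w → trans (cong (_+ Rx+2y Z w) (*-zeroˡ (𝟙 w))) (+-identityˡ _))

graft-𝟙 : graft 𝟙 ≗ 𝕪
graft-𝟙 = R[]-cong _ (λ w → trans (cong₂ _+_ (*-identityˡ (𝟙 w)) (cong₂ _+_ (R[]-𝟘 _ w) (R[]-𝟘 _ w)))
                                    (+-identityʳ (𝟙 w)))

μ : Series → Series → Series
μ A B = A ⋄ R y B ⊕ R y A ⋄ B ⊖ Rx+y (A ⋄ B)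

Rx+2y-⋄ : ∀ A B → Rx+2y A ⋄ B ≗ Rx+y (A ⋄ B) ⊕ R y A ⋄ B
Rx+2y-⋄ A B = ≗-trans (⋄-distribʳ-⊕ (Rx+y A) (R y A) B) (⊕-congʳ (R y A ⋄ B) (Rx+y-⋄ A B))

⋄-Rx+2y : ∀ A B → A ⋄ Rx+2y B ≗ Rx+y (A ⋄ B) ⊕ A ⋄ R y B
⋄-Rx+2y A B = ≗-trans (⋄-distribˡ-⊕ A (Rx+y B) (R y B)) (⊕-congʳ (A ⋄ R y B) (⋄-Rx+y A B))

μ-𝟙 : ∀ Z → μ 𝟙 Z ≗ R y Z ⊕ 𝕪 ⋄ Z ⊖ Rx+y Z
μ-𝟙 Z = ⊖-cong (⊕-congʳ (𝕪 ⋄ Z) (⋄-identityˡ (R y Z))) (R[]-cong _ (⋄-identityˡ Z))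

GraftIdentity : Series → Series → Set
GraftIdentity u v =
  graft u ⋄ graft v ⊖ graft (u ⋄ graft v) ⊖ graft (graft u ⋄ v) ⊕ graft (graft (u ⋄ v))
  ≗ 𝕪 ⋄ graft (u ⋄ v) ⊖ graft (𝕪 ⋄ (u ⋄ v))

module _ (P Q : Series) where
  private
    r s t : Series → Series
    r = Rx+y
    s = R y
    t = Rx+2y

    M μ₀ μ₁ μ₂ K X Xl Xr X₄ X₅ Y : Series
    M  = μ P Q
    μ₀ = μ (t P) (t Q)
    μ₁ = μ P (t Q)
    μ₂ = μ (t P) Q
    K  = μ 𝟙 M
    X  = P ⋄ Q
    Xl = P ⋄ s Q
    Xr = s P ⋄ Q
    X₄ = P ⋄ s (t Q)
    X₅ = s (t P) ⋄ Q
    Y  = 𝕪 ⋄ M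

    vanishes : ∀ {f g} → f ≗ g → f ⊖ g ≗ 𝟘
    vanishes {f} {g} f≗g w = trans (cong (λ a → a + - g w) (f≗g w)) (+-inverseʳ (g w))

    -- E vanishes because it is a linear combination of the relations d₁, …, d₆.
    E : Series
    E = X₄ ⊕ X₅ ⊖ t P ⋄ t Q ⊖ μ₁ ⊖ μ₂ ⊕ t M ⊕ t M ⊖ Y ⊕ K

    E≗𝟘 : E ≗ 𝟘
    E≗𝟘 = begin
      E
        ≈⟨ combination X₄ X₅ (t P ⋄ t Q) (s P ⋄ t Q) (r (P ⋄ t Q)) (t P ⋄ s Q) (r (t P ⋄ Q))
                       (r M) (s M) Y K (r Xr) (r Xl) (r (r X)) ⟩
      d₅ ⊕ d₄ ⊕ d₆ ⊖ d₁ ⊖ d₂ ⊖ d₂ ⊖ d₃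
        ≈⟨ ⊖-cong (⊖-cong (⊖-cong (⊖-cong (⊕-cong (⊕-cong d₅≗𝟘 d₄≗𝟘) d₆≗𝟘) d₁≗𝟘) d₂≗𝟘) d₂≗𝟘)
                  d₃≗𝟘 ⟩
      𝟘 ⊕ 𝟘 ⊕ 𝟘 ⊖ 𝟘 ⊖ 𝟘 ⊖ 𝟘 ⊖ 𝟘
        ≈⟨ (λ _ → refl) ⟩
      𝟘 ∎
      where
      open ≗-Reasoning
      d₁ d₂ d₃ d₄ d₅ d₆ : Series
      d₁ = t P ⋄ t Q ⊖ (r (P ⋄ t Q) ⊕ s P ⋄ t Q)
      d₂ = s P ⋄ t Q ⊖ (r Xr ⊕ s M)
      d₃ = t P ⋄ s Q ⊖ (r Xl ⊕ s M)
      d₄ = r (t P ⋄ Q) ⊖ (r (r X) ⊕ r Xr)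
      d₅ = r M ⊖ (r Xl ⊕ r Xr ⊖ r (r X))
      d₆ = K ⊖ (s M ⊕ Y ⊖ r M)

      d₁≗𝟘 : d₁ ≗ 𝟘
      d₁≗𝟘 = vanishes (Rx+2y-⋄ P (t Q))
      d₂≗𝟘 : d₂ ≗ 𝟘
      d₂≗𝟘 = vanishes (≗-trans (⋄-Rx+2y (s P) Q) (⊕-congˡ (r Xr) (⋄-R-R y P Q)))
      d₃≗𝟘 : d₃ ≗ 𝟘
      d₃≗𝟘 = vanishes (≗-trans (Rx+2y-⋄ P (s Q)) (⊕-congˡ (r Xl) (⋄-R-R y P Q)))
      d₄≗𝟘 : d₄ ≗ 𝟘
      d₄≗𝟘 = vanishes (≗-trans (R[]-cong _ (Rx+2y-⋄ P Q)) (R[]-⊕ _ (r X) Xr))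
      d₅≗𝟘 : d₅ ≗ 𝟘
      d₅≗𝟘 = vanishes {r M} {r Xl ⊕ r Xr ⊖ r (r X)} (λ { [] → refl ; (_ ∷ _) → refl })
      d₆≗𝟘 : d₆ ≗ 𝟘
      d₆≗𝟘 = vanishes (μ-𝟙 M)

      combination : ∀ x₄ x₅ a b c d f rm sm yy k rxr rxl rrx →
        x₄ ⊕ x₅ ⊖ a ⊖ (x₄ ⊕ b ⊖ c) ⊖ (d ⊕ x₅ ⊖ f) ⊕ (rm ⊕ sm) ⊕ (rm ⊕ sm) ⊖ yy ⊕ k
        ≗ (rm ⊖ (rxl ⊕ rxr ⊖ rrx)) ⊕ (f ⊖ (rrx ⊕ rxr)) ⊕ (k ⊖ (sm ⊕ yy ⊖ rm))
          ⊖ (a ⊖ (c ⊕ b)) ⊖ (b ⊖ (rxr ⊕ sm)) ⊖ (b ⊖ (rxr ⊕ sm)) ⊖ (d ⊖ (rxl ⊕ sm))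
      combination x₄ x₅ a b c d f rm sm yy k rxr rxl rrx w =
        lemma (x₄ w) (x₅ w) (a w) (b w) (c w) (d w) (f w) (rm w) (sm w) (yy w) (k w) (rxr w) (rxl w) (rrx w)
        where
        lemma : ∀ x₄ x₅ a b c d f rm sm yy k rxr rxl rrx →
          x₄ + x₅ + - a + - (x₄ + b + - c) + - (d + x₅ + - f) + (rm + sm) + (rm + sm) + - yy + k
          ≡ rm + - (rxl + rxr + - rrx) + (f + - (rrx + rxr)) + (k + - (sm + yy + - rm))
            + - (a + - (c + b)) + - (b + - (rxr + sm)) + - (b + - (rxr + sm)) + - (d + - (rxl + sm))
        lemma = solve-∀ ℚ-ring

    expand-μ₀ : μ₀ ≗ (r X₄ ⊕ s μ₁) ⊕ (r X₅ ⊕ s μ₂) ⊖ r (t P ⋄ t Q)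
    expand-μ₀ = ⊖-congʳ (r (t P ⋄ t Q))
      (⊕-cong (≗-trans (Rx+2y-⋄ P (s (t Q))) (⊕-congˡ (r X₄) (⋄-R-R y P (t Q))))
              (≗-trans (⋄-Rx+2y (s (t P)) Q) (⊕-congˡ (r X₅) (⋄-R-R y (t P) Q))))

    expand-μ𝟙 : μ 𝟙 (t M) ≗ s (t M) ⊕ (r Y ⊕ s K) ⊖ r (t M)
    expand-μ𝟙 = ≗-trans (μ-𝟙 (t M))
      (⊖-congʳ (r (t M)) (⊕-congˡ (s (t M)) (≗-trans (⋄-Rx+2y 𝕪 M) (⊕-congˡ (r Y) (⋄-R-R y 𝟙 M)))))

    core : μ₀ ⊖ t μ₁ ⊖ t μ₂ ⊕ t (t M) ≗ μ 𝟙 (t M) ⊖ t K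
    core = begin
      μ₀ ⊖ t μ₁ ⊖ t μ₂ ⊕ t (t M)
        ≈⟨ ⊕-congʳ (t (t M)) (⊖-congʳ (t μ₂) (⊖-congʳ (t μ₁) expand-μ₀)) ⟩
      (r X₄ ⊕ s μ₁) ⊕ (r X₅ ⊕ s μ₂) ⊖ r (t P ⋄ t Q) ⊖ t μ₁ ⊖ t μ₂ ⊕ t (t M)
        ≈⟨ regroup (r X₄) (s μ₁) (r X₅) (s μ₂) (r (t P ⋄ t Q)) (r μ₁) (r μ₂)
                   (r (t M)) (s (t M)) (r Y) (s K) (r K) ⟩
      (s (t M) ⊕ (r Y ⊕ s K) ⊖ r (t M) ⊖ t K) ⊕
        (r X₄ ⊕ r X₅ ⊖ r (t P ⋄ t Q) ⊖ r μ₁ ⊖ r μ₂ ⊕ r (t M) ⊕ r (t M) ⊖ r Y ⊕ r K)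
        ≈⟨ ⊕-cong (⊖-congʳ (t K) (≗-sym expand-μ𝟙)) (λ { [] → refl ; (_ ∷ _) → refl }) ⟩
      (μ 𝟙 (t M) ⊖ t K) ⊕ r E
        ≈⟨ ⊕-congˡ (μ 𝟙 (t M) ⊖ t K) (≗-trans (R[]-cong _ E≗𝟘) (R[]-𝟘 _)) ⟩
      (μ 𝟙 (t M) ⊖ t K) ⊕ 𝟘
        ≈⟨ (λ w → +-identityʳ _) ⟩
      μ 𝟙 (t M) ⊖ t K ∎
      where
      open ≗-Reasoning
      regroup : ∀ a₄ sμ₁ a₅ sμ₂ rPQ rμ₁ rμ₂ rtM stM rY sK rK →
        (a₄ ⊕ sμ₁) ⊕ (a₅ ⊕ sμ₂) ⊖ rPQ ⊖ (rμ₁ ⊕ sμ₁) ⊖ (rμ₂ ⊕ sμ₂) ⊕ (rtM ⊕ stM)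
        ≗ (stM ⊕ (rY ⊕ sK) ⊖ rtM ⊖ (rK ⊕ sK))
          ⊕ (a₄ ⊕ a₅ ⊖ rPQ ⊖ rμ₁ ⊖ rμ₂ ⊕ rtM ⊕ rtM ⊖ rY ⊕ rK)
      regroup a₄ sμ₁ a₅ sμ₂ rPQ rμ₁ rμ₂ rtM stM rY sK rK w =
        lemma (a₄ w) (sμ₁ w) (a₅ w) (sμ₂ w) (rPQ w) (rμ₁ w) (rμ₂ w) (rtM w) (stM w) (rY w) (sK w) (rK w)
        where
        lemma : ∀ a₄ sμ₁ a₅ sμ₂ rPQ rμ₁ rμ₂ rtM stM rY sK rK →
          a₄ + sμ₁ + (a₅ + sμ₂) + - rPQ + - (rμ₁ + sμ₁) + - (rμ₂ + sμ₂) + (rtM + stM)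
          ≡ stM + (rY + sK) + - rtM + - (rK + sK) + (a₄ + a₅ + - rPQ + - rμ₁ + - rμ₂ + rtM + rtM + - rY + rK)
        lemma = solve-∀ ℚ-ring

  graft-identity : GraftIdentity (R y P) (R y Q)
  graft-identity = begin
    graft u ⋄ graft v ⊖ graft (u ⋄ graft v) ⊖ graft (graft u ⋄ v) ⊕ graft (graft (u ⋄ v))
      ≈⟨ ⊕-cong (⊖-cong (⊖-cong term₁ term₂) term₃) term₄ ⟩
    s μ₀ ⊖ s (t μ₁) ⊖ s (t μ₂) ⊕ s (t (t M))
      ≈⟨ (λ { [] → refl ; (x ∷ _) → refl ; (y ∷ _) → refl }) ⟩
    s (μ₀ ⊖ t μ₁ ⊖ t μ₂ ⊕ t (t M))
      ≈⟨ R[]-cong _ core ⟩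
    s (μ 𝟙 (t M) ⊖ t K)
      ≈⟨ R[]-⊖ _ (μ 𝟙 (t M)) (t K) ⟩
    s (μ 𝟙 (t M)) ⊖ s (t K)
      ≈⟨ ⊖-cong term₅ term₆ ⟨
    𝕪 ⋄ graft (u ⋄ v) ⊖ graft (𝕪 ⋄ (u ⋄ v)) ∎
    where
    open ≗-Reasoning
    u v : Series
    u = s P
    v = s Q

    term₁ : graft u ⋄ graft v ≗ s μ₀
    term₁ = ≗-trans (⋄-cong (graft-R-y P) (graft-R-y Q)) (⋄-R-R y (t P) (t Q))
    term₂ : graft (u ⋄ graft v) ≗ s (t μ₁)
    term₂ = ≗-trans (graft-cong (≗-trans (⋄-congˡ u (graft-R-y Q)) (⋄-R-R y P (t Q)))) (graft-R-y μ₁)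
    term₃ : graft (graft u ⋄ v) ≗ s (t μ₂)
    term₃ = ≗-trans (graft-cong (≗-trans (⋄-congʳ v (graft-R-y P)) (⋄-R-R y (t P) Q))) (graft-R-y μ₂)
    term₄ : graft (graft (u ⋄ v)) ≗ s (t (t M))
    term₄ = ≗-trans (graft-cong (≗-trans (graft-cong (⋄-R-R y P Q)) (graft-R-y M))) (graft-R-y (t M))
    term₅ : 𝕪 ⋄ graft (u ⋄ v) ≗ s (μ 𝟙 (t M))
    term₅ = ≗-trans (⋄-congˡ 𝕪 (≗-trans (graft-cong (⋄-R-R y P Q)) (graft-R-y M))) (⋄-R-R y 𝟙 (t M))
    term₆ : graft (𝕪 ⋄ (u ⋄ v)) ≗ s (t K)
    term₆ = ≗-trans (graft-cong (≗-trans (⋄-congˡ 𝕪 (⋄-R-R y P Q)) (⋄-R-R y 𝟙 M))) (graft-R-y K)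

graft-identity-𝟙ˡ : ∀ v → GraftIdentity 𝟙 v
graft-identity-𝟙ˡ v = begin
  graft 𝟙 ⋄ graft v ⊖ graft (𝟙 ⋄ graft v) ⊖ graft (graft 𝟙 ⋄ v) ⊕ graft (graft (𝟙 ⋄ v))
    ≈⟨ ⊕-cong (⊖-cong (⊖-cong (⋄-congʳ (graft v) graft-𝟙) (graft-cong (⋄-identityˡ (graft v))))
                      (graft-cong (⋄-congʳ v graft-𝟙)))
              (graft-cong (graft-cong (⋄-identityˡ v))) ⟩
  𝕪 ⋄ graft v ⊖ graft (graft v) ⊖ graft (𝕪 ⋄ v) ⊕ graft (graft v)
    ≈⟨ (λ w → lemma ((𝕪 ⋄ graft v) w) (graft (graft v) w) (graft (𝕪 ⋄ v) w)) ⟩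
  𝕪 ⋄ graft v ⊖ graft (𝕪 ⋄ v)
    ≈⟨ ⊖-cong (⋄-congˡ 𝕪 (graft-cong (⋄-identityˡ v))) (graft-cong (⋄-congˡ 𝕪 (⋄-identityˡ v))) ⟨
  𝕪 ⋄ graft (𝟙 ⋄ v) ⊖ graft (𝕪 ⋄ (𝟙 ⋄ v)) ∎
  where
  open ≗-Reasoning
  lemma : ∀ a b c → a + - b + - c + b ≡ a + - c
  lemma = solve-∀ ℚ-ring

graft-identity-𝟙ʳ : ∀ u → GraftIdentity u 𝟙
graft-identity-𝟙ʳ u = begin
  graft u ⋄ graft 𝟙 ⊖ graft (u ⋄ graft 𝟙) ⊖ graft (graft u ⋄ 𝟙) ⊕ graft (graft (u ⋄ 𝟙))
    ≈⟨ ⊕-cong (⊖-cong (⊖-cong (≗-trans (⋄-congˡ (graft u) graft-𝟙) (⋄-𝕪-comm (graft u)))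
                              (graft-cong (≗-trans (⋄-congˡ u graft-𝟙) (⋄-𝕪-comm u))))
                      (graft-cong (⋄-identityʳ (graft u))))
              (graft-cong (graft-cong (⋄-identityʳ u))) ⟩
  𝕪 ⋄ graft u ⊖ graft (𝕪 ⋄ u) ⊖ graft (graft u) ⊕ graft (graft u)
    ≈⟨ (λ w → lemma ((𝕪 ⋄ graft u) w) (graft (𝕪 ⋄ u) w) (graft (graft u) w)) ⟩
  𝕪 ⋄ graft u ⊖ graft (𝕪 ⋄ u)
    ≈⟨ ⊖-cong (⋄-congˡ 𝕪 (graft-cong (⋄-identityʳ u))) (graft-cong (⋄-congˡ 𝕪 (⋄-identityʳ u))) ⟨
  𝕪 ⋄ graft (u ⋄ 𝟙) ⊖ graft (𝕪 ⋄ (u ⋄ 𝟙)) ∎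
  where
  open ≗-Reasoning
  lemma : ∀ a b c → a + - b + - c + c ≡ a + - b
  lemma = solve-∀ ℚ-ring

graft^ : ℕ → Series → Series
graft^ k f = fold f graft k

graft^-cong : ∀ k {f g} → f ≗ g → graft^ k f ≗ graft^ k g
graft^-cong zero    f≗g = f≗g
graft^-cong (suc k) f≗g = graft-cong (graft^-cong k f≗g)

graft^-⊕ : ∀ k f g → graft^ k (f ⊕ g) ≗ graft^ k f ⊕ graft^ k g
graft^-⊕ zero    f g = ≗-refl
graft^-⊕ (suc k) f g = ≗-trans (graft-cong (graft^-⊕ k f g)) (graft-⊕ (graft^ k f) (graft^ k g))

graft^-⊝ : ∀ k f → graft^ k (⊝ f) ≗ ⊝ graft^ k f
graft^-⊝ zero    f = ≗-refl
graft^-⊝ (suc k) f = ≗-trans (graft-cong (graft^-⊝ k f)) (graft-⊝ (graft^ k f))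

graft^-⊖ : ∀ k f g → graft^ k (f ⊖ g) ≗ graft^ k f ⊖ graft^ k g
graft^-⊖ k f g = ≗-trans (graft^-⊕ k f (⊝ g)) (⊕-congˡ (graft^ k f) (graft^-⊝ k g))

graft^-𝟘 : ∀ k → graft^ k 𝟘 ≗ 𝟘
graft^-𝟘 zero    = ≗-refl
graft^-𝟘 (suc k) = ≗-trans (graft-cong (graft^-𝟘 k)) graft-𝟘

graft^-∑ : ∀ {A : Set} k (as : List A) f → graft^ k (∑ as f) ≗ ∑[ a ∈ as ] graft^ k (f a)
graft^-∑ k []       f = graft^-𝟘 k
graft^-∑ k (a ∷ as) f = ≗-trans (graft^-⊕ k (f a) (∑ as f)) (⊕-congˡ (graft^ k (f a)) (graft^-∑ k as f))

graft^-graft : ∀ k f → graft^ k (graft f) ≡ graft (graft^ k f)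
graft^-graft zero    f = refl
graft^-graft (suc k) f = cong graft (graft^-graft k f)

graft^-+ : ∀ a b f → graft^ a (graft^ b f) ≡ graft^ (a +ℕ b) f
graft^-+ a b f = sym (fold-+ f graft a)

unroll : ∀ (Y t : ℕ → Series) → (∀ k → Y (suc k) ≗ graft (Y k) ⊕ t k) →
         ∀ n → Y n ≗ graft^ n (Y 0) ⊕ ∑[ j ∈ upTo n ] graft^ (n ∸ suc j) (t j)
unroll Y t step zero    w = sym (+-identityʳ (Y 0 w))
unroll Y t step (suc n) = begin
  Y (suc n)
    ≈⟨ unroll (Y ∘ suc) (t ∘ suc) (step ∘ suc) n ⟩
  graft^ n (Y 1) ⊕ ∑[ j ∈ upTo n ] graft^ (n ∸ suc j) (t (suc j))
    ≈⟨ ⊕-congʳ _ (≗-trans (graft^-cong n (step 0)) (graft^-⊕ n (graft (Y 0)) (t 0))) ⟩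
  graft^ n (graft (Y 0)) ⊕ graft^ n (t 0) ⊕ ∑[ j ∈ upTo n ] graft^ (n ∸ suc j) (t (suc j))
    ≈⟨ (λ w → trans (cong (λ f → f w + graft^ n (t 0) w + rest w) (graft^-graft n (Y 0)))
                    (+-assoc (graft^ (suc n) (Y 0) w) (graft^ n (t 0) w) (rest w))) ⟩
  graft^ (suc n) (Y 0) ⊕ (graft^ n (t 0) ⊕ rest)
    ≈⟨ ⊕-congˡ (graft^ (suc n) (Y 0)) (≗-sym (∑-upTo-suc n (λ j → graft^ (suc n ∸ suc j) (t j)))) ⟩
  graft^ (suc n) (Y 0) ⊕ ∑[ j ∈ upTo (suc n) ] graft^ (suc n ∸ suc j) (t j) ∎
  where
  open ≗-Reasoning
  rest : Series
  rest = ∑[ j ∈ upTo n ] graft^ (n ∸ suc j) (t (suc j))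

ℓ : ℕ → Series
ℓ k = graft^ k 𝟙

graft-identity-ℓ : ∀ i j → GraftIdentity (ℓ i) (ℓ j)
graft-identity-ℓ zero    j       = graft-identity-𝟙ˡ (ℓ j)
graft-identity-ℓ (suc i) zero    = graft-identity-𝟙ʳ (ℓ (suc i))
graft-identity-ℓ (suc i) (suc j) = graft-identity _ _

T : ℕ → ℕ → Series
T i j = 𝕪 ⋄ graft (ℓ i ⋄ ℓ j) ⊖ graft (𝕪 ⋄ (ℓ i ⋄ ℓ j))

ladder-product : ∀ m n →
  ℓ m ⋄ ℓ n ≗ ℓ (m +ℕ n)
              ⊕ ∑[ i ∈ upTo m ] ∑[ j ∈ upTo n ] graft^ ((m ∸ suc i) +ℕ (n ∸ suc j)) (T i j)
ladder-product m n = begin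
  ℓ m ⋄ ℓ n
    ≈⟨ unroll (λ i → ℓ i ⋄ ℓ n) (λ i → Y i n)
              (λ i w → split ((ℓ (suc i) ⋄ ℓ n) w) (graft (ℓ i ⋄ ℓ n) w)) m ⟩
  graft^ m (𝟙 ⋄ ℓ n) ⊕ ∑[ i ∈ upTo m ] graft^ (m ∸ suc i) (Y i n)
    ≈⟨ ⊕-cong (graft^-cong m (⋄-identityˡ (ℓ n)))
              (∑-cong (upTo m) λ i → ≗-trans (graft^-cong (m ∸ suc i) (row i))
                                             (graft^-∑ (m ∸ suc i) (upTo n) _)) ⟩
  graft^ m (ℓ n) ⊕ ∑[ i ∈ upTo m ] ∑[ j ∈ upTo n ] graft^ (m ∸ suc i) (graft^ (n ∸ suc j) (T i j))
    ≈⟨ ⊕-cong (λ w → cong (λ f → f w) (graft^-+ m n 𝟙))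
              (∑-cong (upTo m) λ i → ∑-cong (upTo n) λ j w →
                 cong (λ f → f w) (graft^-+ (m ∸ suc i) (n ∸ suc j) (T i j))) ⟩
  ℓ (m +ℕ n) ⊕ ∑[ i ∈ upTo m ] ∑[ j ∈ upTo n ] graft^ ((m ∸ suc i) +ℕ (n ∸ suc j)) (T i j) ∎
  where
  open ≗-Reasoning
  Y : ℕ → ℕ → Series
  Y i j = ℓ (suc i) ⋄ ℓ j ⊖ graft (ℓ i ⋄ ℓ j)

  split : ∀ a b → a ≡ b + (a + - b)
  split = solve-∀ ℚ-ring

  Y-step : ∀ i j → Y i (suc j) ≗ graft (Y i j) ⊕ T i j
  Y-step i j w = trans (lemma ((ℓ (suc i) ⋄ ℓ (suc j)) w) (graft (ℓ i ⋄ ℓ (suc j)) w)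
                              (graft (ℓ (suc i) ⋄ ℓ j) w) (graft (graft (ℓ i ⋄ ℓ j)) w))
                       (cong₂ _+_ (sym (graft-⊖ (ℓ (suc i) ⋄ ℓ j) (graft (ℓ i ⋄ ℓ j)) w))
                                                  (graft-identity-ℓ i j w))
    where
    lemma : ∀ a b c e → a + - b ≡ c + - e + (a + - b + - c + e)
    lemma = solve-∀ ℚ-ring

  Y-zero : ∀ i → Y i 0 ≗ 𝟘
  Y-zero i w = trans (cong₂ (λ a b → a + - b) (⋄-identityʳ (ℓ (suc i)) w) (graft-cong (⋄-identityʳ (ℓ i)) w))
                     (+-inverseʳ (ℓ (suc i) w))

  row : ∀ i → Y i n ≗ ∑[ j ∈ upTo n ] graft^ (n ∸ suc j) (T i j)
  row i = ≗-trans (unroll (Y i) (T i) (Y-step i) n)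
                  (λ w → trans (cong (_+ (∑[ j ∈ upTo n ] graft^ (n ∸ suc j) (T i j)) w)
                                     (trans (graft^-cong n (Y-zero i) w) (graft^-𝟘 n w)))
                               (+-identityˡ _))

⟦_⟧ᵗ : Tree → Series
⟦ t ⟧ᵗ = coeff (Ftree t)

⟦_⟧ : Forest → Series
⟦ f ⟧ = coeff (Fforest f)

⟦_⟧ᴴ : HElem → Series
⟦ h ⟧ᴴ = ∑ h (λ (c , f) → c · ⟦ f ⟧)

coeff-σ : ∀ h → coeff (σ h) ≗ ⟦ h ⟧ᴴ
coeff-σ h = ≗-trans (coeff-concatMap _ h) (∑-cong h (λ (c , f) → coeff-scale c (Fforest f)))

⟦⟧-[] : ⟦ [] ⟧ ≗ 𝟙
⟦⟧-[] = ≗-trans (coeff-single []) δ-[]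

⟦⟧-∷ : ∀ t ts → ⟦ t ∷ ts ⟧ ≗ ⟦ t ⟧ᵗ ⋄ ⟦ ts ⟧
⟦⟧-∷ t ts = coeff-◇ (Ftree t) (Fforest ts)

⟦⟧-single : ∀ t → ⟦ t ∷ [] ⟧ ≗ ⟦ t ⟧ᵗ
⟦⟧-single t = ≗-trans (⟦⟧-∷ t []) (≗-trans (⋄-congˡ ⟦ t ⟧ᵗ ⟦⟧-[]) (⋄-identityʳ ⟦ t ⟧ᵗ))

⟦•⟧ : ⟦ • ⟧ᵗ ≗ 𝕪
⟦•⟧ = ≗-trans (coeff-single (y ∷ [])) (≗-trans (δ-∷ y []) (R[]-cong _ δ-[]))

⟦•∷⟧ : ∀ f → ⟦ • ∷ f ⟧ ≗ 𝕪 ⋄ ⟦ f ⟧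
⟦•∷⟧ f = ≗-trans (⟦⟧-∷ • f) (⋄-congʳ ⟦ f ⟧ ⟦•⟧)

coeff-grow : ∀ p → coeff (grow p) ≗ R y (Rx+2y (R⁻¹ y (coeff p)))
coeff-grow []                = ≗-sym (≗-trans (R[]-cong _ (⊕-cong (R[]-𝟘 _) (R[]-𝟘 _))) (R[]-𝟘 _))
coeff-grow ((c , [])    ∷ p) = coeff-grow p
coeff-grow ((c , x ∷ v) ∷ p) = coeff-grow p
coeff-grow ((c , y ∷ v) ∷ p) = λ
  { []          → coeff-grow p []
  ; (x ∷ w)     → coeff-grow p (x ∷ w)
  ; (y ∷ [])    → coeff-grow p (y ∷ [])
  ; (y ∷ x ∷ w) → yx w
  ; (y ∷ y ∷ w) → yy w
  }
  where
  yx : ∀ w → coeff ((c , y ∷ x ∷ v) ∷ ((1ℚ + 1ℚ) * c , y ∷ y ∷ v) ∷ grow p) (y ∷ x ∷ w)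
             ≡ coeff ((c , y ∷ v) ∷ p) (y ∷ w) + 0ℚ
  yx w with wordEq v w
  ... | true  = trans (cong (c +_) (coeff-grow p (y ∷ x ∷ w))) (sym (+-assoc c _ 0ℚ))
  ... | false = coeff-grow p (y ∷ x ∷ w)
  yy : ∀ w → coeff ((c , y ∷ x ∷ v) ∷ ((1ℚ + 1ℚ) * c , y ∷ y ∷ v) ∷ grow p) (y ∷ y ∷ w)
             ≡ coeff ((c , y ∷ v) ∷ p) (y ∷ w) + coeff ((c , y ∷ v) ∷ p) (y ∷ w)
  yy w with wordEq v w
  ... | true  = trans (cong ((1ℚ + 1ℚ) * c +_) (coeff-grow p (y ∷ y ∷ w))) (lemma c (coeff p (y ∷ w)))
    where
    lemma : ∀ c a → (1ℚ + 1ℚ) * c + (a + a) ≡ c + a + (c + a)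
    lemma = solve-∀ ℚ-ring
  ... | false = coeff-grow p (y ∷ y ∷ w)

⟦⟧ᵗ-[] : ∀ t → ⟦ t ⟧ᵗ [] ≡ 0ℚ
⟦⟧ᵗ-[] (node [])       = refl
⟦⟧ᵗ-[] (node (t ∷ ts)) = coeff-grow (Fforest (t ∷ ts)) []

⟦node⟧ : ∀ f → ⟦ node f ⟧ᵗ ≗ graft ⟦ f ⟧
⟦node⟧ []       = ≗-trans ⟦•⟧ (≗-sym (≗-trans (graft-cong ⟦⟧-[]) graft-𝟙))
⟦node⟧ (t ∷ ts) = ≗-trans (coeff-grow (Fforest (t ∷ ts))) (R[]-cong _ (λ w → sym (constant-vanishes w)))
  where
  constant-vanishes : ∀ w → ⟦ t ∷ ts ⟧ [] * 𝟙 w + Rx+2y (R⁻¹ y ⟦ t ∷ ts ⟧) w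
                            ≡ Rx+2y (R⁻¹ y ⟦ t ∷ ts ⟧) w
  constant-vanishes w =
    trans (cong (λ a → a * 𝟙 w + Rx+2y (R⁻¹ y ⟦ t ∷ ts ⟧) w)
                (trans (⟦⟧-∷ t ts []) (trans (cong (_* ⟦ ts ⟧ []) (⟦⟧ᵗ-[] t)) (*-zeroˡ (⟦ ts ⟧ [])))))
          (trans (cong (_+ Rx+2y (R⁻¹ y ⟦ t ∷ ts ⟧) w) (*-zeroˡ (𝟙 w))) (+-identityˡ _))

⟦B₊^⟧ : ∀ k f → ⟦ B₊^ k f ⟧ ≗ graft^ k ⟦ f ⟧
⟦B₊^⟧ zero    f = ≗-refl
⟦B₊^⟧ (suc k) f =
  ≗-trans (⟦⟧-single (node (B₊^ k f))) (≗-trans (⟦node⟧ (B₊^ k f)) (graft-cong (⟦B₊^⟧ k f)))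

⟦L⟧ : ∀ k → ⟦ L k ⟧ ≗ ℓ k
⟦L⟧ zero    = ⟦⟧-[]
⟦L⟧ (suc k) w = begin
  ⟦ B₊^ k (• ∷ []) ⟧ w                ≡⟨ ⟦B₊^⟧ k (• ∷ []) w ⟩
  graft^ k ⟦ • ∷ [] ⟧ w
    ≡⟨ graft^-cong k (≗-trans (⟦⟧-single •) (≗-trans ⟦•⟧ (≗-sym graft-𝟙))) w ⟩
  graft^ k (graft 𝟙) w                ≡⟨ cong (λ f → f w) (graft^-graft k 𝟙) ⟩
  ℓ (suc k) w                         ∎
  where open ≡-Reasoning

⟦L++L⟧ : ∀ i j → ⟦ L i ++ L j ⟧ ≗ ℓ i ⋄ ℓ j
⟦L++L⟧ zero    j = ≗-trans (⟦L⟧ j) (≗-sym (⋄-identityˡ (ℓ j)))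
⟦L++L⟧ (suc i) j = ≗-trans (split i) (⋄-cong (⟦L⟧ (suc i)) (⟦L⟧ j))
  where
  single-++ : ∀ t → ⟦ t ∷ L j ⟧ ≗ ⟦ t ∷ [] ⟧ ⋄ ⟦ L j ⟧
  single-++ t = ≗-trans (⟦⟧-∷ t (L j)) (⋄-congʳ ⟦ L j ⟧ (≗-sym (⟦⟧-single t)))
  split : ∀ i → ⟦ L (suc i) ++ L j ⟧ ≗ ⟦ L (suc i) ⟧ ⋄ ⟦ L j ⟧
  split zero    = single-++ •
  split (suc i) = single-++ (node (B₊^ i (• ∷ [])))

module _ (e : ℕ) (i j : ℕ) where
  private
    A B : Series
    A = 𝕪 ⋄ graft (ℓ i ⋄ ℓ j)
    B = graft (𝕪 ⋄ (ℓ i ⋄ ℓ j))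

    grafted : ⟦ B₊^ e (• ∷ B₊ (L i ++ L j) ∷ []) ⟧ ≗ graft^ e (𝕪 ⋄ graft (ℓ i ⋄ ℓ j))
    grafted = ≗-trans (⟦B₊^⟧ e (• ∷ B₊ (L i ++ L j) ∷ []))
                (graft^-cong e (≗-trans (⟦•∷⟧ (B₊ (L i ++ L j) ∷ [])) (⋄-congˡ 𝕪
                  (≗-trans (⟦⟧-single (node (L i ++ L j)))
                           (≗-trans (⟦node⟧ (L i ++ L j)) (graft-cong (⟦L++L⟧ i j)))))))

    ungrafted : ⟦ B₊^ (suc e) (• ∷ (L i ++ L j)) ⟧ ≗ graft^ e (graft (𝕪 ⋄ (ℓ i ⋄ ℓ j)))
    ungrafted w = begin
      ⟦ B₊^ (suc e) (• ∷ (L i ++ L j)) ⟧ w          ≡⟨ ⟦B₊^⟧ (suc e) (• ∷ (L i ++ L j)) w ⟩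
      graft (graft^ e ⟦ • ∷ (L i ++ L j) ⟧) w        ≡⟨ cong (λ f → f w) (graft^-graft e ⟦ • ∷ (L i ++ L j) ⟧) ⟨
      graft^ e (graft ⟦ • ∷ (L i ++ L j) ⟧) w
        ≡⟨ graft^-cong e (graft-cong (≗-trans (⟦•∷⟧ (L i ++ L j)) (⋄-congˡ 𝕪 (⟦L++L⟧ i j)))) w ⟩
      graft^ e (graft (𝕪 ⋄ (ℓ i ⋄ ℓ j))) w           ∎
      where open ≡-Reasoning

  block : ⟦ (- 1ℚ , B₊^ e (• ∷ B₊ (L i ++ L j) ∷ [])) ∷ (1ℚ , B₊^ (suc e) (• ∷ (L i ++ L j))) ∷ [] ⟧ᴴ
          ≗ ⊝ graft^ e (T i j)
  block w = trans (cong₂ (λ a b → - 1ℚ * a + (1ℚ * b + 0ℚ)) (grafted w) (ungrafted w))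
                  (trans (lemma (graft^ e A w) (graft^ e B w)) (cong -_ (sym (graft^-⊖ e A B w))))
    where
    lemma : ∀ a b → - 1ℚ * a + (1ℚ * b + 0ℚ) ≡ - (a + - b)
    lemma = solve-∀ ℚ-ring

  corner-block : ⟦ (- 1ℚ , B₊^ e (• ∷ B₊ (L i ++ L j) ∷ [])) ∷ [] ⟧ᴴ
                 ≗ ⊝ graft^ e (T i j) ⊖ graft^ e (graft (𝕪 ⋄ (ℓ i ⋄ ℓ j)))
  corner-block w = trans (cong (λ a → - 1ℚ * a + 0ℚ) (grafted w))
                         (trans (lemma (graft^ e A w) (graft^ e B w))
                                (cong (λ t → - t + - graft^ e B w) (sym (graft^-⊖ e A B w))))
    where
    lemma : ∀ a b → - 1ℚ * a + 0ℚ ≡ - (a + - b) + - b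
    lemma = solve-∀ ℚ-ring

-- σ of the (i, j) summands of f_{m,n}; the summand (0, 0) has no second term.
summand : ℕ → ℕ → ℕ → ℕ → Series
summand m n zero zero =
  ⊝ graft^ (m ∸ 1 +ℕ (n ∸ 1)) (T 0 0) ⊖ graft^ (m ∸ 1 +ℕ (n ∸ 1)) (graft (𝕪 ⋄ (ℓ 0 ⋄ ℓ 0)))
summand m n i    j    = ⊝ graft^ ((m ∸ 1 ∸ i) +ℕ (n ∸ 1 ∸ j)) (T i j)

⟦fmn⟧ : ∀ m n →
  ⟦ fmn m n ⟧ᴴ ≗ 1ℚ · ⟦ L m ++ L n ⟧ ⊕ ∑[ i ∈ upTo m ] ∑[ j ∈ upTo n ] summand m n i j
⟦fmn⟧ m n = ⊕-congˡ (1ℚ · ⟦ L m ++ L n ⟧) (≗-trans (∑-concatMap _ (upTo m) _) (∑-cong (upTo m) λ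
  { zero    → ≗-trans (∑-concatMap _ (upTo n) _) (∑-cong (upTo n) λ
                { zero    → corner-block (m ∸ 1 +ℕ (n ∸ 1)) 0 0
                ; (suc j) → block (m ∸ 1 +ℕ (n ∸ 1 ∸ suc j)) 0 (suc j) })
  ; (suc i) → ≗-trans (∑-concatMap _ (upTo n) _)
                (∑-cong (upTo n) λ j → block ((m ∸ 1 ∸ suc i) +ℕ (n ∸ 1 ∸ j)) (suc i) j) }))

fmn-vanishes : ∀ m n → ⟦ fmn (suc m) (suc n) ⟧ᴴ ≗ 𝟘
fmn-vanishes m n = begin
  ⟦ fmn (suc m) (suc n) ⟧ᴴ
    ≈⟨ ⟦fmn⟧ (suc m) (suc n) ⟩
  1ℚ · ⟦ L (suc m) ++ L (suc n) ⟧ ⊕ ∑[ i ∈ upTo (suc m) ] ∑[ j ∈ upTo (suc n) ] summand (suc m) (suc n) i j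
    ≈⟨ ⊕-cong (≗-trans (·-identity _) (⟦L++L⟧ (suc m) (suc n)))
              (∑∑-corner m n (summand (suc m) (suc n)) (λ i j → ⊝ G i j) corner
                         ≗-refl (λ _ → ≗-refl) (λ _ _ → ≗-refl)) ⟩
  ℓ (suc m) ⋄ ℓ (suc n) ⊕ (∑[ i ∈ upTo (suc m) ] ∑[ j ∈ upTo (suc n) ] (⊝ G i j) ⊖ corner)
    ≈⟨ ⊕-cong (ladder-product (suc m) (suc n)) (⊖-cong ∑∑⊝ corner≗ℓ) ⟩
  ℓ (suc m +ℕ suc n) ⊕ S ⊕ (⊝ S ⊖ ℓ (suc m +ℕ suc n))
    ≈⟨ (λ w → lemma (ℓ (suc m +ℕ suc n) w) (S w)) ⟩
  𝟘 ∎
  where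
  open ≗-Reasoning
  G : ℕ → ℕ → Series
  G i j = graft^ ((m ∸ i) +ℕ (n ∸ j)) (T i j)

  S corner : Series
  S = ∑[ i ∈ upTo (suc m) ] ∑[ j ∈ upTo (suc n) ] G i j
  corner = graft^ (m +ℕ n) (graft (𝕪 ⋄ (ℓ 0 ⋄ ℓ 0)))

  ∑∑⊝ : ∑[ i ∈ upTo (suc m) ] ∑[ j ∈ upTo (suc n) ] (⊝ G i j) ≗ ⊝ S
  ∑∑⊝ = ≗-trans (∑-cong (upTo (suc m)) (λ i → ∑-⊝ (upTo (suc n)) (G i)))
                (∑-⊝ (upTo (suc m)) (λ i → ∑[ j ∈ upTo (suc n) ] G i j))

  corner≗ℓ : corner ≗ ℓ (suc m +ℕ suc n)
  corner≗ℓ w = trans (graft^-cong (m +ℕ n) (graft-cong 𝕪⋄𝟙⋄𝟙) w)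
                     (cong (λ f → f w) (trans (graft^-+ (m +ℕ n) 2 𝟙) (cong ℓ exponent)))
    where
    𝕪⋄𝟙⋄𝟙 : 𝕪 ⋄ (𝟙 ⋄ 𝟙) ≗ graft 𝟙
    𝕪⋄𝟙⋄𝟙 = ≗-trans (⋄-congˡ 𝕪 (⋄-identityˡ 𝟙)) (≗-trans (⋄-identityʳ 𝕪) (≗-sym graft-𝟙))
    exponent : m +ℕ n +ℕ 2 ≡ suc m +ℕ suc n
    exponent = trans (+-comm (m +ℕ n) 2) (cong suc (sym (+-suc m n)))

  lemma : ∀ c s → c + s + (- s + - c) ≡ 0ℚ
  lemma = solve-∀ ℚ-ring

theorem3p3 : (m n : ℕ) → 1 ≤ m → 1 ≤ n → (w : Word) → coeff (σ (fmn m n)) w ≡ 0ℚ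
theorem3p3 (suc m) (suc n) (s≤s z≤n) (s≤s z≤n) w = trans (coeff-σ (fmn (suc m) (suc n)) w) (fmn-vanishes m n w)
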